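{- Let $k\geq 2$ be an integer, $0<\alpha<\frac{1}{2}$, and $n\geq \frac{36k}{\alpha}$. If $G$ is a maximal $C_{2k+1}$-free graph belonging to $\mathcal{G}_{k,\alpha}(n)$ (defined below), then $e(G)\geq \frac{n^2}{4}-2\sqrt{k\alpha}\,n^{3/2}$ and every induced complete bipartite subgraph of $G$ has at most $\left(1-\frac{\alpha}{4}\right)n$ vertices.
   Context: $C_{2k+1}$ is the cycle of length $2k+1$. A graph $G$ is maximal $C_{2k+1}$-free if it has no subgraph isomorphic to $C_{2k+1}$ and adding any edge of the complement of $G$ creates a copy of $C_{2k+1}$. $e(G)$ is the number of edges. For $k\geq 2$, $0<\alpha<\frac12$ and $t=\lceil\sqrt{\alpha n/(4k)}\rceil$, the class $\mathcal{G}_{k,\alpha}(n)$ consists of all simple graphs $G$ on $n$ vertices whose vertex set can be partitioned into sets $X_1,\dots,X_{t+1},Y_1,\dots,Y_{t+1},Z_1,\dots,Z_t$ such that: (i) for each $i=1,\dots,t$, $|Z_i|=2k-1$ and $G[Z_i]$ contains a path of length $2k-2$, say $z^i_1z^i_2\dots z^i_{2k-1}$; (ii) for each $i=1,\dots,t$, $|X_i|=|Y_i|=\left\lfloor\frac{\alpha n-(2k-1)t}{2t}\right\rfloor$, and $X_{t+1},Y_{t+1}$ is a balanced partition (sizes differ by at most one) of $V(G)\setminus\bigcup_{i=1}^t(X_i\cup Y_i\cup Z_i)$; (iii) both $X_1\cup\dots\cup X_{t+1}$ and $Y_1\cup\dots\cup Y_{t+1}$ are independent sets in $G$; (iv) for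 each $i=1,\dots,t$ there are no edges between $X_i$ and $Y_i$, every vertex of $X_{t+1}$ is adjacent to every vertex of $Y_{t+1}$, and for all distinct $i,j\in\{1,\dots,t+1\}$ every vertex of $X_i$ is adjacent to every vertex of $Y_j$; (v) for each $i=1,\dots,t$, $z^i_1$ is adjacent to every vertex of $X_i$ and $z^i_{2k-1}$ is adjacent to every vertex of $Y_i$. (Other edges, e.g. involving $Z$, are not restricted beyond these conditions.)
   Formalization: The parameter α is rational, with $0<\alpha<\frac{1}{2}$. -}

module Defs where

open import Data.Nat as ℕ using (ℕ; zero; suc; _+_; _*_; _∸_; _<_; _<ᵇ_)
open import Data.Integer as ℤ using (ℤ; +_)
import Data.Rational as ℚ
open ℚ using (ℚ; _/_; 0ℚ; 1ℚ) renaming (floor to ℚfloor)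
open import Data.Fin using (Fin; zero; suc; toℕ; inject₁; fromℕ; _≟_)
open import Data.Fin.Subset using (Subset; _∈_; ∣_∣; Nonempty)
open import Data.Bool using (Bool; true; false; _∧_; _∨_; if_then_else_)
open import Data.List using (List; map; allFin; filter; length)
open import Data.Nat.ListAction using (sum)
open import Data.Product using (Σ; ∃; _×_; _,_)
open import Data.Sum using (_⊎_)
import Data.Empty
open import Function.Definitions using (Injective)
open import Relation.Nullary using (¬_; does)
open import Relation.Binary.PropositionalEquality using (_≡_; _≢_)

ℕ→ℚ : ℕ → ℚ
ℕ→ℚ m = (+ m) / 1

record Graph (n : ℕ) : Set where
  field
    adj    : Fin n → Fin n → Bool
    sym    : ∀ u v → adj u v ≡ adj v u
    irrefl : ∀ v → adj v v ≡ false
open Graph public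

edgeCount : ∀ {n} → Graph n → ℕ
edgeCount {n} G =
  sum (map (λ u → sum (map (λ v → if (toℕ u <ᵇ toℕ v) ∧ adj G u v then 1 else 0)
                                (allFin n)))
           (allFin n))

addEdgeAdj : ∀ {n} → (Fin n → Fin n → Bool) → Fin n → Fin n → Fin n → Fin n → Bool
addEdgeAdj a u v x y =
  a x y ∨ (does (x ≟ u) ∧ does (y ≟ v)) ∨ (does (x ≟ v) ∧ does (y ≟ u))

HasCycle : ∀ {n} → (Fin n → Fin n → Bool) → ℕ → Set
HasCycle {n} a zero    = Data.Empty.⊥
HasCycle {n} a (suc m) =
  Σ (Fin (suc m) → Fin n) λ f →
    Injective _≡_ _≡_ f
    × (∀ (i : Fin m) → a (f (inject₁ i)) (f (suc i)) ≡ true)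
    × a (f (fromℕ m)) (f zero) ≡ true

MaximalCycleFree : ∀ {n} → Graph n → ℕ → Set
MaximalCycleFree {n} G L =
  ¬ HasCycle (adj G) L
  × (∀ (u v : Fin n) → u ≢ v → adj G u v ≡ false →
       HasCycle (addEdgeAdj (adj G) u v) L)

IsCeilSqrt : ℚ → ℕ → Set
IsCeilSqrt x t = (x ℚ.≤ ℕ→ℚ (t * t)) × (∀ (m : ℕ) → x ℚ.≤ ℕ→ℚ (m * m) → t ℕ.≤ m)

-- Labels of the parts X_1..X_{t+1}, Y_1..Y_{t+1}, Z_1..Z_t
-- (index i : Fin (suc t) stands for X_{i+1}; toℕ i ≡ t is X_{t+1}).
data Part (t : ℕ) : Set where
  xPart : Fin (suc t) → Part t
  yPart : Fin (suc t) → Part t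
  zPart : Fin t → Part t

partSize : ∀ {n t} → (Fin n → Part t) → (Part t → Bool) → ℕ
partSize {n} lab isP = length (filter (λ v → isP (lab v) Data.Bool.≟ true) (allFin n))
  where import Data.Bool

isX : ∀ {t} → Fin (suc t) → Part t → Bool
isX i (xPart j) = does (i ≟ j)
isX i _         = false

isY : ∀ {t} → Fin (suc t) → Part t → Bool
isY i (yPart j) = does (i ≟ j)
isY i _         = false

-- ⌊ (αn − (2k−1)t) / (2t) ⌋  (for t ≥ 1; t = 0 never occurs since
-- t = ⌈√(αn/4k)⌉ ≥ 1 when α, n > 0).
blockSize : ℕ → ℚ → ℕ → ℕ → ℤ
blockSize k α n zero    = + 0
blockSize k α n (suc t') =
  ℚfloor ((α ℚ.* ℕ→ℚ n ℚ.- ℕ→ℚ ((2 * k ∸ 1) * suc t')) ℚ.* (+ 1 / (2 * suc t')))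

-- Membership in 𝒢_{k,α}(n), given t = ⌈√(αn/(4k))⌉.
-- Z_i has 2k-1 = suc (2k-2) vertices, listed as z i 0, …, z i (2k-2),
-- forming the path z^i_1 … z^i_{2k-1} of length 2k-2.
record InClassG (k : ℕ) (α : ℚ) (n t : ℕ) (G : Graph n) : Set where
  field
    lab : Fin n → Part t
    z   : Fin t → Fin (suc (2 * k ∸ 2)) → Fin n
    -- (i) Z_i is exactly {z i j}, so |Z_i| = 2k-1, and G[Z_i] contains the path
    z-inj   : ∀ i → Injective _≡_ _≡_ (z i)
    z-lab   : ∀ i j → lab (z i j) ≡ zPart i
    z-onto  : ∀ i v → lab v ≡ zPart i → ∃ λ j → z i j ≡ v
    z-path  : ∀ i (j : Fin (2 * k ∸ 2)) → adj G (z i (inject₁ j)) (z i (suc j)) ≡ true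
    -- (ii) sizes; X_{t+1}, Y_{t+1} balanced (they cover the rest since lab is total)
    X-size  : ∀ (i : Fin t) → + partSize lab (isX (inject₁ i)) ≡ blockSize k α n t
    Y-size  : ∀ (i : Fin t) → + partSize lab (isY (inject₁ i)) ≡ blockSize k α n t
    balanced : (partSize lab (isX (fromℕ t)) ℕ.≤ suc (partSize lab (isY (fromℕ t))))
             × (partSize lab (isY (fromℕ t)) ℕ.≤ suc (partSize lab (isX (fromℕ t))))
    X-indep : ∀ u v i j → lab u ≡ xPart i → lab v ≡ xPart j → adj G u v ≡ false
    Y-indep : ∀ u v i j → lab u ≡ yPart i → lab v ≡ yPart j → adj G u v ≡ false
    XiYi-none : ∀ (i : Fin t) u v → lab u ≡ xPart (inject₁ i) → lab v ≡ yPart (inject₁ i)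
                → adj G u v ≡ false
    Xt1Yt1-all : ∀ u v → lab u ≡ xPart (fromℕ t) → lab v ≡ yPart (fromℕ t) → adj G u v ≡ true
    XiYj-all : ∀ (i j : Fin (suc t)) u v → i ≢ j → lab u ≡ xPart i → lab v ≡ yPart j
               → adj G u v ≡ true
    z-first : ∀ (i : Fin t) v → lab v ≡ xPart (inject₁ i) → adj G (z i zero) v ≡ true
    z-last  : ∀ (i : Fin t) v → lab v ≡ yPart (inject₁ i)
              → adj G (z i (fromℕ (2 * k ∸ 2))) v ≡ true

InducedCompleteBipartite : ∀ {n} → Graph n → Subset n → Subset n → Set
InducedCompleteBipartite {n} G A B =
  Nonempty A × Nonempty B
  × (∀ v → v ∈ A → ¬ (v ∈ B))
  × (∀ u v → u ∈ A → v ∈ A → adj G u v ≡ false)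
  × (∀ u v → u ∈ B → v ∈ B → adj G u v ≡ false)
  × (∀ u v → u ∈ A → v ∈ B → adj G u v ≡ true)

-- q / d for a natural d (the value at d = 0 is an irrelevant convention;
-- it is only used with d = 4k, k ≥ 2).
divℕ : ℚ → ℕ → ℚ
divℕ q zero    = 0ℚ
divℕ q (suc d) = q ℚ.* (+ 1 / suc d)

{-# OPTIONS --safe #-}
module Submission where

-- X = ⋃ Xᵢ and Y = ⋃ Yᵢ are independent, |Z| ≤ (2k−1)t, and every X–Y pair is an edge except
-- inside the t pairs (Xᵢ, Yᵢ), whose parts have the common size s = ⌊(αn − (2k−1)t)/2t⌋. Hence
-- e(G) ≥ |X||Y| − ts², n ≤ |X| + |Y| + (2k−1)t and ||X| − |Y|| ≤ 1, which together give
-- n² − 4e(G) ≤ 4k(t−1)n + 4kn + 4ts² + 1. As (t−1)² ≤ αn/4k ≤ t² and 2ts ≤ αn, each term on the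
-- right is O(√(kαn³)), and the sum is at most 8√(kαn³).
--
-- In an induced complete bipartite subgraph H, non-adjacency is transitive on V(H). If H meets
-- both Xᵢ and Yᵢ for some i ≤ t, those two non-adjacent vertices keep H away from all of X ∪ Y
-- outside Xᵢ ∪ Yᵢ; otherwise H misses Xᵢ or Yᵢ for every i. Either way H misses at least
-- ts ≥ αn/4 vertices.

module ℕ→ℚ-Properties where
  open import Defs using (ℕ→ℚ)
  open import Data.Nat as ℕ using (ℕ; suc)
  import Data.Nat.Properties as ℕP
  open import Data.Integer as ℤ using (ℤ; +_)
  import Data.Integer.Properties as ℤP
  import Data.Integer.DivMod as ℤDivMod
  open import Data.Integer.Solver renaming (module +-*-Solver to ℤSolver)
  open import Data.Rational as ℚ using (ℚ; mkℚ; _/_; 1ℚ; toℚᵘ)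
  import Data.Rational.Properties as ℚP
  open import Data.Rational.Unnormalised as ℚᵘ using (mkℚᵘ; *≡*; *≤*)
  import Data.Rational.Unnormalised.Properties as ℚᵘP
  open import Data.Product using (_×_; _,_)
  open import Relation.Binary.PropositionalEquality
  open import Data.Rational.Solver renaming (module +-*-Solver to ℚSolver)

  toℚᵘ-ℕ→ℚ : ∀ m → toℚᵘ (ℕ→ℚ m) ℚᵘ.≃ mkℚᵘ (+ m) 0
  toℚᵘ-ℕ→ℚ m = ℚP.toℚᵘ-fromℚᵘ (mkℚᵘ (+ m) 0)

  ℕ→ℚ-+ : ∀ m n → ℕ→ℚ (m ℕ.+ n) ≡ ℕ→ℚ m ℚ.+ ℕ→ℚ n
  ℕ→ℚ-+ m n = ℚP.toℚᵘ-injective (begin-equality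
    toℚᵘ (ℕ→ℚ (m ℕ.+ n))                 ≃⟨ toℚᵘ-ℕ→ℚ (m ℕ.+ n) ⟩
    mkℚᵘ (+ (m ℕ.+ n)) 0                 ≃⟨ *≡* integers ⟩
    mkℚᵘ (+ m) 0 ℚᵘ.+ mkℚᵘ (+ n) 0       ≃⟨ ℚᵘP.+-cong (toℚᵘ-ℕ→ℚ m) (toℚᵘ-ℕ→ℚ n) ⟨
    toℚᵘ (ℕ→ℚ m) ℚᵘ.+ toℚᵘ (ℕ→ℚ n)       ≃⟨ ℚP.toℚᵘ-homo-+ (ℕ→ℚ m) (ℕ→ℚ n) ⟨
    toℚᵘ (ℕ→ℚ m ℚ.+ ℕ→ℚ n)               ∎)
    where
    open ℚᵘP.≤-Reasoning
    open ℤSolver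
    integers : + (m ℕ.+ n) ℤ.* + 1 ≡ (+ m ℤ.* + 1 ℤ.+ + n ℤ.* + 1) ℤ.* + 1
    integers = trans (cong (ℤ._* + 1) (ℤP.pos-+ m n))
      (solve 2 (λ a b → (a :+ b) :* con (+ 1) := (a :* con (+ 1) :+ b :* con (+ 1)) :* con (+ 1)) refl (+ m) (+ n))

  ℕ→ℚ-* : ∀ m n → ℕ→ℚ (m ℕ.* n) ≡ ℕ→ℚ m ℚ.* ℕ→ℚ n
  ℕ→ℚ-* m n = ℚP.toℚᵘ-injective (begin-equality
    toℚᵘ (ℕ→ℚ (m ℕ.* n))                 ≃⟨ toℚᵘ-ℕ→ℚ (m ℕ.* n) ⟩
    mkℚᵘ (+ (m ℕ.* n)) 0                 ≃⟨ *≡* integers ⟩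
    mkℚᵘ (+ m) 0 ℚᵘ.* mkℚᵘ (+ n) 0       ≃⟨ ℚᵘP.*-cong (toℚᵘ-ℕ→ℚ m) (toℚᵘ-ℕ→ℚ n) ⟨
    toℚᵘ (ℕ→ℚ m) ℚᵘ.* toℚᵘ (ℕ→ℚ n)       ≃⟨ ℚP.toℚᵘ-homo-* (ℕ→ℚ m) (ℕ→ℚ n) ⟨
    toℚᵘ (ℕ→ℚ m ℚ.* ℕ→ℚ n)               ∎)
    where
    open ℚᵘP.≤-Reasoning
    integers : + (m ℕ.* n) ℤ.* + 1 ≡ (+ m ℤ.* + n) ℤ.* + 1
    integers = cong (ℤ._* + 1) (ℤP.pos-* m n)

  ℕ→ℚ-suc : ∀ m → ℕ→ℚ (suc m) ≡ ℕ→ℚ m ℚ.+ 1ℚ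
  ℕ→ℚ-suc m = trans (ℕ→ℚ-+ 1 m) (ℚP.+-comm 1ℚ (ℕ→ℚ m))

  ℕ→ℚ-∸ : ∀ {m n} → n ℕ.≤ m → ℕ→ℚ (m ℕ.∸ n) ≡ ℕ→ℚ m ℚ.- ℕ→ℚ n
  ℕ→ℚ-∸ {m} {n} n≤m = begin
    ℕ→ℚ (m ℕ.∸ n)                                   ≡⟨ solve 2 (λ x y → x := x :+ y :- y) refl (ℕ→ℚ (m ℕ.∸ n)) (ℕ→ℚ n) ⟩
    ℕ→ℚ (m ℕ.∸ n) ℚ.+ ℕ→ℚ n ℚ.- ℕ→ℚ n               ≡⟨ cong (ℚ._- ℕ→ℚ n) (ℕ→ℚ-+ (m ℕ.∸ n) n) ⟨
    ℕ→ℚ (m ℕ.∸ n ℕ.+ n) ℚ.- ℕ→ℚ n                   ≡⟨ cong (λ x → ℕ→ℚ x ℚ.- ℕ→ℚ n) (ℕP.m∸n+n≡m n≤m) ⟩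
    ℕ→ℚ m ℚ.- ℕ→ℚ n                                 ∎
    where
    open ≡-Reasoning
    open ℚSolver

  ℕ→ℚ-mono-≤ : ∀ {m n} → m ℕ.≤ n → ℕ→ℚ m ℚ.≤ ℕ→ℚ n
  ℕ→ℚ-mono-≤ {m} {n} m≤n = ℚP.toℚᵘ-cancel-≤ (begin
    toℚᵘ (ℕ→ℚ m)   ≃⟨ toℚᵘ-ℕ→ℚ m ⟩
    mkℚᵘ (+ m) 0   ≤⟨ *≤* (subst₂ ℤ._≤_ (sym (ℤP.*-identityʳ (+ m))) (sym (ℤP.*-identityʳ (+ n))) (ℤ.+≤+ m≤n)) ⟩
    mkℚᵘ (+ n) 0   ≃⟨ toℚᵘ-ℕ→ℚ n ⟨
    toℚᵘ (ℕ→ℚ n)   ∎)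
    where open ℚᵘP.≤-Reasoning

  ℕ→ℚ-cancel-≤ : ∀ {m n} → ℕ→ℚ m ℚ.≤ ℕ→ℚ n → m ℕ.≤ n
  ℕ→ℚ-cancel-≤ {m} {n} h with ℚᵘP.≤-respʳ-≃ (toℚᵘ-ℕ→ℚ n) (ℚᵘP.≤-respˡ-≃ (toℚᵘ-ℕ→ℚ m) (ℚP.toℚᵘ-mono-≤ h))
  ... | *≤* m*1≤n*1 = ℤP.drop‿+≤+ (subst₂ ℤ._≤_ (ℤP.*-identityʳ (+ m)) (ℤP.*-identityʳ (+ n)) m*1≤n*1)

  ℕ→ℚ-nonNeg : ∀ m → ℚ.0ℚ ℚ.≤ ℕ→ℚ m
  ℕ→ℚ-nonNeg m = ℕ→ℚ-mono-≤ {0} {m} ℕ.z≤n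

  1/n*n≡1 : ∀ n .{{_ : ℕ.NonZero n}} → (+ 1 / n) ℚ.* ℕ→ℚ n ≡ 1ℚ
  1/n*n≡1 n@(suc n-1) = ℚP.toℚᵘ-injective (begin-equality
    toℚᵘ ((+ 1 / n) ℚ.* ℕ→ℚ n)              ≃⟨ ℚP.toℚᵘ-homo-* (+ 1 / n) (ℕ→ℚ n) ⟩
    toℚᵘ (+ 1 / n) ℚᵘ.* toℚᵘ (ℕ→ℚ n)        ≃⟨ ℚᵘP.*-cong (ℚP.toℚᵘ-fromℚᵘ (mkℚᵘ (+ 1) n-1)) (toℚᵘ-ℕ→ℚ n) ⟩
    mkℚᵘ (+ 1) n-1 ℚᵘ.* mkℚᵘ (+ n) 0        ≃⟨ *≡* integers ⟩
    toℚᵘ 1ℚ                                 ∎)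
    where
    open ℚᵘP.≤-Reasoning
    integers : (+ 1 ℤ.* + n) ℤ.* + 1 ≡ + 1 ℤ.* + (n ℕ.* 1)
    integers = trans (ℤP.*-identityʳ _) (trans (ℤP.*-identityˡ (+ n))
                 (sym (trans (ℤP.*-identityˡ _) (cong +_ (ℕP.*-identityʳ n)))))

  p*1/n*n≡p : ∀ p n .{{_ : ℕ.NonZero n}} → (p ℚ.* (+ 1 / n)) ℚ.* ℕ→ℚ n ≡ p
  p*1/n*n≡p p n = begin
    (p ℚ.* (+ 1 / n)) ℚ.* ℕ→ℚ n   ≡⟨ ℚP.*-assoc p (+ 1 / n) (ℕ→ℚ n) ⟩
    p ℚ.* ((+ 1 / n) ℚ.* ℕ→ℚ n)   ≡⟨ cong (p ℚ.*_) (1/n*n≡1 n) ⟩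
    p ℚ.* 1ℚ                      ≡⟨ ℚP.*-identityʳ p ⟩
    p                             ∎
    where open ≡-Reasoning

  floor-bounds : ∀ q s → ℚ.floor q ≡ + s → (ℕ→ℚ s ℚ.≤ q) × (q ℚ.≤ ℕ→ℚ (suc s))
  floor-bounds q@(mkℚ num den-1 _) s ⌊q⌋≡s = lower , upper
    where
    den : ℕ
    den = suc den-1
    quotient : num ℤDivMod./ℕ den ≡ + s
    quotient = trans (sym (ℤDivMod.div-pos-is-/ℕ num den)) ⌊q⌋≡s
    lower : ℕ→ℚ s ℚ.≤ q
    lower = ℚP.toℚᵘ-cancel-≤ (ℚᵘP.≤-respˡ-≃ (ℚᵘP.≃-sym (toℚᵘ-ℕ→ℚ s))
      (*≤* (subst₂ ℤ._≤_ (cong (ℤ._* + den) quotient) (sym (ℤP.*-identityʳ num)) (ℤDivMod.[n/ℕd]*d≤n num den))))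
    upper : q ℚ.≤ ℕ→ℚ (suc s)
    upper = ℚP.toℚᵘ-cancel-≤ (ℚᵘP.≤-respʳ-≃ (ℚᵘP.≃-sym (toℚᵘ-ℕ→ℚ (suc s)))
      (*≤* (subst₂ ℤ._≤_ (sym (ℤP.*-identityʳ num)) (cong (λ x → ℤ.suc x ℤ.* + den) quotient)
        (ℤP.<⇒≤ (ℤDivMod.n<s[n/ℕd]*d num den)))))

module ℚ-Inequalities where
  import Data.Nat as ℕ
  open import Data.Integer using (+_)
  open import Data.Rational
  open import Data.Rational.Properties
  open import Data.Rational.Solver using (module +-*-Solver)
  open import Data.Sum using (_⊎_; inj₁; inj₂)
  open import Relation.Binary.PropositionalEquality
  open import Relation.Nullary using (yes; no)
  open +-*-Solver

  0≤+ : ∀ {p q} → 0ℚ ≤ p → 0ℚ ≤ q → 0ℚ ≤ p + q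
  0≤+ = +-mono-≤

  0≤* : ∀ {p q} → 0ℚ ≤ p → 0ℚ ≤ q → 0ℚ ≤ p * q
  0≤* {p} {q} 0≤p 0≤q =
    nonNegative⁻¹ (p * q) {{nonNeg*nonNeg⇒nonNeg p {{nonNegative 0≤p}} q {{nonNegative 0≤q}}}}

  0≤/ : ∀ m d .{{_ : ℕ.NonZero d}} → 0ℚ ≤ + m / d
  0≤/ m d = nonNegative⁻¹ _ {{normalize-nonNeg m d}}

  ≤⇒0≤- : ∀ {p q} → p ≤ q → 0ℚ ≤ q - p
  ≤⇒0≤- {p} {q} p≤q = subst (_≤ q - p) (+-inverseʳ p) (+-monoˡ-≤ (- p) p≤q)

  0≤-⇒≤ : ∀ {p q} → 0ℚ ≤ q - p → p ≤ q
  0≤-⇒≤ {p} {q} 0≤q-p = subst₂ _≤_ (+-identityˡ p) q-p+p≡q (+-monoˡ-≤ p 0≤q-p)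
    where
    q-p+p≡q : q - p + p ≡ q
    q-p+p≡q = solve 2 (λ q p → q :- p :+ p := q) refl q p

  0≤-resp-≡ : ∀ {p q} → p ≡ q → 0ℚ ≤ q → 0ℚ ≤ p
  0≤-resp-≡ refl 0≤q = 0≤q

  -- The inequalities below are proved by writing q − p as an explicit combination of manifestly
  -- nonnegative terms; the ring solver checks the identity.
  ≤-by-difference : ∀ {p q d} → q - p ≡ d → 0ℚ ≤ d → p ≤ q
  ≤-by-difference q-p≡d 0≤d = 0≤-⇒≤ (0≤-resp-≡ q-p≡d 0≤d)

  0≤sq : ∀ p → 0ℚ ≤ p * p
  0≤sq p with ≤-total 0ℚ p
  ... | inj₁ 0≤p = 0≤* 0≤p 0≤p
  ... | inj₂ p≤0 = 0≤-resp-≡ (solve 1 (λ p → p :* p := (con 0ℚ :- p) :* (con 0ℚ :- p)) refl p)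
                     (0≤* (≤⇒0≤- p≤0) (≤⇒0≤- p≤0))

  sq-mono-≤ : ∀ {p q} → 0ℚ ≤ p → p ≤ q → p * p ≤ q * q
  sq-mono-≤ {p} {q} 0≤p p≤q = ≤-by-difference
    (solve 2 (λ p q → q :* q :- p :* p := (q :- p) :* ((q :- p) :+ con (+ 2 / 1) :* p)) refl p q)
    (0≤* (≤⇒0≤- p≤q) (0≤+ (≤⇒0≤- p≤q) (0≤* (0≤/ 2 1) 0≤p)))

  sq-sum4≤ : ∀ a b c d → (a + b + c + d) * (a + b + c + d) ≤ + 4 / 1 * (a * a + b * b + c * c + d * d)
  sq-sum4≤ a b c d = ≤-by-difference
    (solve 4 (λ a b c d →
       con (+ 4 / 1) :* (a :* a :+ b :* b :+ c :* c :+ d :* d) :- (a :+ b :+ c :+ d) :* (a :+ b :+ c :+ d)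
       := (a :- b) :* (a :- b) :+ (a :- c) :* (a :- c) :+ (a :- d) :* (a :- d)
          :+ (b :- c) :* (b :- c) :+ (b :- d) :* (b :- d) :+ (c :- d) :* (c :- d)) refl a b c d)
    (0≤+ (0≤+ (0≤+ (0≤+ (0≤+ (0≤sq (a - b)) (0≤sq (a - c))) (0≤sq (a - d))) (0≤sq (b - c)))
      (0≤sq (b - d))) (0≤sq (c - d)))

  0≤*-cancelˡ : ∀ {p q} → 0ℚ < p → 0ℚ ≤ p * q → 0ℚ ≤ q
  0≤*-cancelˡ {p} {q} 0<p 0≤pq =
    *-cancelˡ-≤-pos p {{positive 0<p}} (subst (_≤ p * q) (sym (*-zeroʳ p)) 0≤pq)

  deficit-bound : ∀ {n x y c e f} → 0ℚ ≤ x → 0ℚ ≤ y → c ≤ n → n ≤ x + y + c →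
                  x ≤ y + 1ℚ → y ≤ x + 1ℚ → x * y ≤ e + f →
                  n * n - + 4 / 1 * e ≤ + 2 / 1 * c * n + + 4 / 1 * f + 1ℚ
  deficit-bound {n} {x} {y} {c} {e} {f} 0≤x 0≤y c≤n n≤x+y+c x≤y+1 y≤x+1 xy≤e+f = ≤-by-difference
    (solve 6 (λ n x y c e f →
       con (+ 2 / 1) :* c :* n :+ con (+ 4 / 1) :* f :+ con 1ℚ :- (n :* n :- con (+ 4 / 1) :* e)
       := con (+ 4 / 1) :* (e :+ f :- x :* y) :+ (y :+ con 1ℚ :- x) :* (x :+ con 1ℚ :- y)
          :+ (x :+ y :+ c :- n) :* (x :+ y :+ (n :- c)) :+ c :* c) refl n x y c e f)
    (0≤+ (0≤+ (0≤+ (0≤* (0≤/ 4 1) (≤⇒0≤- xy≤e+f)) (0≤* (≤⇒0≤- x≤y+1) (≤⇒0≤- y≤x+1)))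
      (0≤* (≤⇒0≤- n≤x+y+c) (0≤+ (0≤+ 0≤x 0≤y) (≤⇒0≤- c≤n)))) (0≤sq c))

  deficit²-bound : ∀ {D a b c R} → + 4 / 1 * D ≤ a + b + c + 1ℚ →
                   a * a ≤ + 4 / 1 * R → b * b ≤ R → c * c ≤ R → 1ℚ ≤ R →
                   D ≤ 0ℚ ⊎ D * D ≤ + 4 / 1 * R
  deficit²-bound {D} {a} {b} {c} {R} 4D≤W a²≤4R b²≤R c²≤R 1≤R with D ≤? 0ℚ
  ... | yes D≤0 = inj₁ D≤0
  ... | no D≰0 = inj₂ (*-cancelˡ-≤-pos (+ 16 / 1) (begin
    + 16 / 1 * (D * D)                         ≡⟨ solve 1 (λ D → con (+ 16 / 1) :* (D :* D) := (con (+ 4 / 1) :* D) :* (con (+ 4 / 1) :* D)) refl D ⟩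
    (+ 4 / 1 * D) * (+ 4 / 1 * D)              ≤⟨ sq-mono-≤ 0≤4D 4D≤W ⟩
    (a + b + c + 1ℚ) * (a + b + c + 1ℚ)        ≤⟨ sq-sum4≤ a b c 1ℚ ⟩
    + 4 / 1 * (a * a + b * b + c * c + 1ℚ)     ≤⟨ *-monoˡ-≤-nonNeg (+ 4 / 1) (+-mono-≤ (+-mono-≤ (+-mono-≤ a²≤4R b²≤R) c²≤R) 1≤R) ⟩
    + 4 / 1 * (+ 4 / 1 * R + R + R + R)        ≤⟨ ≤-by-difference slack (0≤* (0≤/ 36 1) 0≤R) ⟩
    + 16 / 1 * (+ 4 / 1 * R)                   ∎))
    where
    open ≤-Reasoning
    0≤4D : 0ℚ ≤ + 4 / 1 * D
    0≤4D = 0≤* (0≤/ 4 1) (<⇒≤ (≰⇒> D≰0))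
    0≤R : 0ℚ ≤ R
    0≤R = ≤-trans (0≤/ 1 1) 1≤R
    slack : + 16 / 1 * (+ 4 / 1 * R) - + 4 / 1 * (+ 4 / 1 * R + R + R + R) ≡ + 36 / 1 * R
    slack = solve 1 (λ R → con (+ 16 / 1) :* (con (+ 4 / 1) :* R) :- con (+ 4 / 1) :* (con (+ 4 / 1) :* R :+ R :+ R :+ R)
                           := con (+ 36 / 1) :* R) refl R

  4k[t-1]n-sq≤ : ∀ {k n u t} → 0ℚ ≤ k → + 4 / 1 * k * (t - 1ℚ) * (t - 1ℚ) ≤ u →
                 (+ 4 / 1 * k * (t - 1ℚ) * n) * (+ 4 / 1 * k * (t - 1ℚ) * n) ≤ + 4 / 1 * (k * n * n * u)
  4k[t-1]n-sq≤ {k} {n} {u} {t} 0≤k 4k[t-1]²≤u = ≤-by-difference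
    (solve 4 (λ k n u t →
       con (+ 4 / 1) :* (k :* n :* n :* u) :- (con (+ 4 / 1) :* k :* (t :- con 1ℚ) :* n) :* (con (+ 4 / 1) :* k :* (t :- con 1ℚ) :* n)
       := con (+ 4 / 1) :* k :* (n :* n) :* (u :- con (+ 4 / 1) :* k :* (t :- con 1ℚ) :* (t :- con 1ℚ))) refl k n u t)
    (0≤* (0≤* (0≤* (0≤/ 4 1) 0≤k) (0≤sq n)) (≤⇒0≤- 4k[t-1]²≤u))

  4kn-sq≤ : ∀ {k n u} → 0ℚ ≤ k → + 36 / 1 * k ≤ u → (+ 4 / 1 * k * n) * (+ 4 / 1 * k * n) ≤ k * n * n * u
  4kn-sq≤ {k} {n} {u} 0≤k 36k≤u = ≤-by-difference
    (solve 3 (λ k n u →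
       k :* n :* n :* u :- (con (+ 4 / 1) :* k :* n) :* (con (+ 4 / 1) :* k :* n)
       := k :* (n :* n) :* (u :- con (+ 36 / 1) :* k) :+ con (+ 20 / 1) :* (k :* k) :* (n :* n)) refl k n u)
    (0≤+ (0≤* (0≤* 0≤k (0≤sq n)) (≤⇒0≤- 36k≤u)) (0≤* (0≤* (0≤/ 20 1) (0≤sq k)) (0≤sq n)))

  -- Multiplied by t², the claim reads (2ts)⁴ ≤ k t² n² u, and (2ts)⁴ ≤ u⁴ ≤ u³ · 4kt² ≤ (n²/4) u · 4kt².
  4ts²-sq≤ : ∀ {k n u t s} → 0ℚ < t → 0ℚ ≤ k → 0ℚ ≤ s → + 2 / 1 * t * s ≤ u → u ≤ + 4 / 1 * k * t * t →
             + 2 / 1 * u ≤ n → (+ 4 / 1 * t * s * s) * (+ 4 / 1 * t * s * s) ≤ k * n * n * u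
  4ts²-sq≤ {k} {n} {u} {t} {s} 0<t 0≤k 0≤s 2ts≤u u≤4kt² 2u≤n = 0≤-⇒≤ (0≤*-cancelˡ 0<t² (0≤-resp-≡
    (solve 5 (λ k n u t s →
       (t :* t) :* (k :* n :* n :* u :- (con (+ 4 / 1) :* t :* s :* s) :* (con (+ 4 / 1) :* t :* s :* s))
       := k :* (t :* t) :* u :* ((n :- con (+ 2 / 1) :* u) :* (n :+ con (+ 2 / 1) :* u))
          :+ u :* u :* u :* (con (+ 4 / 1) :* k :* t :* t :- u)
          :+ (u :- con (+ 2 / 1) :* t :* s) :* (u :+ con (+ 2 / 1) :* t :* s)
             :* (u :* u :+ (con (+ 2 / 1) :* t :* s) :* (con (+ 2 / 1) :* t :* s))) refl k n u t s)
    (0≤+ (0≤+ (0≤* (0≤* (0≤* 0≤k (0≤sq t)) 0≤u) (0≤* (≤⇒0≤- 2u≤n) 0≤n+2u))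
              (0≤* (0≤* (0≤* 0≤u 0≤u) 0≤u) (≤⇒0≤- u≤4kt²)))
         (0≤* (0≤* (≤⇒0≤- 2ts≤u) (0≤+ 0≤u 0≤2ts)) (0≤+ (0≤sq u) (0≤sq (+ 2 / 1 * t * s)))))))
    where
    0<t² : 0ℚ < t * t
    0<t² = positive⁻¹ (t * t) {{pos*pos⇒pos t {{positive 0<t}} t {{positive 0<t}}}}
    0≤2ts : 0ℚ ≤ + 2 / 1 * t * s
    0≤2ts = 0≤* (0≤* (0≤/ 2 1) (<⇒≤ 0<t)) 0≤s
    0≤u : 0ℚ ≤ u
    0≤u = ≤-trans 0≤2ts 2ts≤u
    0≤n+2u : 0ℚ ≤ n + + 2 / 1 * u
    0≤n+2u = 0≤+ (≤-trans (0≤* (0≤/ 2 1) 0≤u) 2u≤n) (0≤* (0≤/ 2 1) 0≤u)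

  1≤knnu : ∀ {k n u} → 1ℚ ≤ k → 1ℚ ≤ n → 1ℚ ≤ u → 1ℚ ≤ k * n * n * u
  1≤knnu {k} {n} {u} 1≤k 1≤n 1≤u = ≤-by-difference
    (solve 3 (λ k n u →
       k :* n :* n :* u :- con 1ℚ
       := (k :- con 1ℚ) :* n :* n :* u :+ (n :- con 1ℚ) :* n :* u :+ (n :- con 1ℚ) :* u :+ (u :- con 1ℚ)) refl k n u)
    (0≤+ (0≤+ (0≤+ (0≤* (0≤* (0≤* (≤⇒0≤- 1≤k) 0≤n) 0≤n) 0≤u) (0≤* (0≤* (≤⇒0≤- 1≤n) 0≤n) 0≤u))
      (0≤* (≤⇒0≤- 1≤n) 0≤u)) (≤⇒0≤- 1≤u))
    where
    0≤n : 0ℚ ≤ n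
    0≤n = ≤-trans (0≤/ 1 1) 1≤n
    0≤u : 0ℚ ≤ u
    0≤u = ≤-trans (0≤/ 1 1) 1≤u

  [4k+2]t≤u : ∀ {k u t} → + 2 / 1 ≤ k → + 36 / 1 * k ≤ u → + 4 / 1 * k * (t - 1ℚ) * (t - 1ℚ) ≤ u →
              (+ 4 / 1 * k + + 2 / 1) * t ≤ u
  [4k+2]t≤u {k} {u} {t} 2≤k 36k≤u 4k[t-1]²≤u = ≤-by-difference
    (solve 3 (λ k u t →
       u :- (con (+ 4 / 1) :* k :+ con (+ 2 / 1)) :* t
       := con ½ :* (u :- con (+ 4 / 1) :* k :* (t :- con 1ℚ) :* (t :- con 1ℚ)) :+ con ½ :* (u :- con (+ 36 / 1) :* k)
          :+ con (+ 2 / 1) :* (k :- con (+ 2 / 1)) :* ((t :- con (+ 2 / 1)) :* (t :- con (+ 2 / 1)) :+ con (+ 6 / 1))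
          :+ con (+ 4 / 1) :* ((t :- con (+ 9 / 4)) :* (t :- con (+ 9 / 4))) :+ con (+ 79 / 4)) refl k u t)
    (0≤+ (0≤+ (0≤+ (0≤+ (0≤* (0≤/ 1 2) (≤⇒0≤- 4k[t-1]²≤u)) (0≤* (0≤/ 1 2) (≤⇒0≤- 36k≤u)))
      (0≤* (0≤* (0≤/ 2 1) (≤⇒0≤- 2≤k)) (0≤+ (0≤sq (t - + 2 / 1)) (0≤/ 6 1))))
      (0≤* (0≤/ 4 1) (0≤sq (t - + 9 / 4)))) (0≤/ 79 4))

  u/4≤ts : ∀ {k u t s} → (+ 4 / 1 * k + + 2 / 1) * t ≤ u →
           u - (+ 2 / 1 * k - 1ℚ) * t ≤ + 2 / 1 * t * (s + 1ℚ) → u * (+ 1 / 4) ≤ t * s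
  u/4≤ts {k} {u} {t} {s} [4k+2]t≤u u-[2k-1]t≤2t[s+1] = ≤-by-difference
    (solve 4 (λ k u t s →
       t :* s :- u :* con (+ 1 / 4)
       := con ½ :* (con (+ 2 / 1) :* t :* (s :+ con 1ℚ) :- (u :- (con (+ 2 / 1) :* k :- con 1ℚ) :* t))
          :+ con (+ 1 / 4) :* (u :- (con (+ 4 / 1) :* k :+ con (+ 2 / 1)) :* t)) refl k u t s)
    (0≤+ (0≤* (0≤/ 1 2) (≤⇒0≤- u-[2k-1]t≤2t[s+1])) (0≤* (0≤/ 1 4) (≤⇒0≤- [4k+2]t≤u)))

module FinSum where
  open import Data.Nat using (ℕ; zero; suc; _+_; _*_; _≤_; z≤n; s≤s)
  open import Data.Nat.Properties hiding (_≟_)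
  open import Data.Fin using (Fin; zero; suc; inject₁; fromℕ; _≟_)
  open import Data.Bool using (Bool; true; false; if_then_else_)
  open import Data.List as List using (List; []; _∷_; allFin; filter; length)
  import Data.List.Properties as ListP
  import Data.Nat.ListAction as ListAction
  open import Data.Vec as Vec using (Vec)
  open import Data.Fin.Subset using (Subset; ∣_∣)
  open import Function using (_∘_)
  open import Relation.Binary.PropositionalEquality
  open import Relation.Nullary using (does; yes; no; contradiction)

  open import Algebra.Properties.Semiring.Sum +-*-semiring public
    using (sum; sum-syntax; sum-cong-≗; ∑-distrib-+; ∑-comm; *-distribˡ-sum; *-distribʳ-sum; sum-init-last; sum-replicate-zero)

  𝟙 : Bool → ℕ
  𝟙 b = if b then 1 else 0

  sum-mono-≤ : ∀ {n} {f g : Fin n → ℕ} → (∀ i → f i ≤ g i) → sum f ≤ sum g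
  sum-mono-≤ {zero}  f≤g = z≤n
  sum-mono-≤ {suc n} f≤g = +-mono-≤ (f≤g zero) (sum-mono-≤ (f≤g ∘ suc))

  sum-const : ∀ n c → ∑[ i < n ] c ≡ n * c
  sum-const zero    c = refl
  sum-const (suc n) c = cong (c +_) (sum-const n c)

  term≤sum : ∀ {n} (f : Fin n → ℕ) i → f i ≤ sum f
  term≤sum f zero    = m≤m+n (f zero) _
  term≤sum f (suc i) = ≤-trans (term≤sum (f ∘ suc) i) (m≤n+m _ (f zero))

  𝟙≤1 : ∀ b → 𝟙 b ≤ 1
  𝟙≤1 true  = s≤s z≤n
  𝟙≤1 false = z≤n

  sum-init≤sum : ∀ {n} (f : Fin (suc n) → ℕ) → ∑[ i < n ] f (inject₁ i) ≤ sum f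
  sum-init≤sum f = ≤-trans (m≤m+n _ _) (≤-reflexive (sym (sum-init-last f)))

  double-sum-+ : ∀ {m n} (f g : Fin m → Fin n → ℕ) →
                 ∑[ i < m ] ∑[ j < n ] (f i j + g i j) ≡ ∑[ i < m ] ∑[ j < n ] f i j + ∑[ i < m ] ∑[ j < n ] g i j
  double-sum-+ f g = trans (sum-cong-≗ (λ i → ∑-distrib-+ (f i) (g i))) (∑-distrib-+ (sum ∘ f) (sum ∘ g))

  double-sum-mono : ∀ {m n} {f g : Fin m → Fin n → ℕ} → (∀ i j → f i j ≤ g i j) →
                    ∑[ i < m ] ∑[ j < n ] f i j ≤ ∑[ i < m ] ∑[ j < n ] g i j
  double-sum-mono f≤g = sum-mono-≤ (λ i → sum-mono-≤ (f≤g i))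

  data LastOrInject₁ {t} : Fin (suc t) → Set where
    last     : LastOrInject₁ (fromℕ t)
    inject₁′ : ∀ j → LastOrInject₁ (inject₁ j)

  lastOrInject₁ : ∀ {t} (a : Fin (suc t)) → LastOrInject₁ a
  lastOrInject₁ {zero}  zero    = last
  lastOrInject₁ {suc t} zero    = inject₁′ zero
  lastOrInject₁ {suc t} (suc a) with lastOrInject₁ a
  ... | last       = last
  ... | inject₁′ j = inject₁′ (suc j)

  does-≟-refl : ∀ {m} (x : Fin m) → does (x ≟ x) ≡ true
  does-≟-refl x with x ≟ x
  ... | yes _   = refl
  ... | no x≢x = contradiction refl x≢x

  sum-𝟙-≟ : ∀ {n} (j : Fin n) → ∑[ i < n ] 𝟙 (does (i ≟ j)) ≡ 1
  sum-𝟙-≟ {suc n} zero    = cong suc (sum-replicate-zero n)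
  sum-𝟙-≟ {suc n} (suc j) = sum-𝟙-≟ j

  sum-allFin : ∀ {n} (f : Fin n → ℕ) → ListAction.sum (List.map f (allFin n)) ≡ sum f
  sum-allFin {n} f = trans (cong ListAction.sum (ListP.map-tabulate (λ i → i) f)) (sum-tabulate f)
    where
    sum-tabulate : ∀ {m} (g : Fin m → ℕ) → ListAction.sum (List.tabulate g) ≡ sum g
    sum-tabulate {zero}  g = refl
    sum-tabulate {suc m} g = cong (g zero +_) (sum-tabulate (g ∘ suc))

  length-filter-≡true : ∀ {A : Set} (b : A → Bool) (xs : List A) →
                       length (filter (λ x → b x Data.Bool.≟ true) xs) ≡ ListAction.sum (List.map (𝟙 ∘ b) xs)
  length-filter-≡true b []       = refl
  length-filter-≡true b (x ∷ xs) with b x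
  ... | true  = cong suc (length-filter-≡true b xs)
  ... | false = length-filter-≡true b xs

  ∣p∣≡sum : ∀ {n} (p : Subset n) → ∣ p ∣ ≡ ∑[ v < n ] 𝟙 (Vec.lookup p v)
  ∣p∣≡sum Vec.[]            = refl
  ∣p∣≡sum (true Vec.∷ p)    = cong suc (∣p∣≡sum p)
  ∣p∣≡sum (false Vec.∷ p)   = ∣p∣≡sum p

module GraphCounting where
  open import Defs using (Graph; adj; edgeCount; InducedCompleteBipartite)
  open import Data.Nat using (ℕ; _+_; _≤_; _<ᵇ_; z≤n; s≤s)
  open import Data.Nat.Properties hiding (_≟_; <-cmp)
  import Data.Nat.ListAction as ListAction
  open import Data.Fin using (Fin; toℕ)
  open import Data.Fin.Properties using (<-cmp)
  open import Data.Fin.Subset using (Subset; _∈_)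
  open import Data.Bool using (Bool; true; false; _∧_)
  open import Data.Bool.Properties using (T-≡; ∧-zeroʳ)
  open import Data.List as List using (allFin)
  open import Data.Product using (_,_)
  open import Data.Sum using (_⊎_; inj₁; inj₂)
  open import Function using (Equivalence)
  open import Relation.Binary using (tri<; tri≈; tri>)
  open import Relation.Binary.PropositionalEquality
  open import Relation.Nullary using (contradiction)
  open FinSum

  adjacent-and-not : ∀ {n} (G : Graph n) {u v} {A : Set} → adj G u v ≡ true → adj G u v ≡ false → A
  adjacent-and-not G u~v u≁v = contradiction (trans (sym u~v) u≁v) λ ()

  module _ {n} (G : Graph n) where

    counted : Fin n → Fin n → ℕ
    counted u v = 𝟙 ((toℕ u <ᵇ toℕ v) ∧ adj G u v)

    edgeCount≡sum : edgeCount G ≡ ∑[ u < n ] ∑[ v < n ] counted u v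
    edgeCount≡sum = trans (sum-allFin (λ u → ListAction.sum (List.map (counted u) (allFin n))))
                      (sum-cong-≗ (λ u → sum-allFin (counted u)))

    adjacent⇒counted : ∀ u v → adj G u v ≡ true → 1 ≤ counted u v + counted v u
    adjacent⇒counted u v u~v with <-cmp u v
    ... | tri< u<v _ _ rewrite Equivalence.to T-≡ (<⇒<ᵇ u<v) | u~v = s≤s z≤n
    ... | tri> _ _ v<u rewrite Equivalence.to T-≡ (<⇒<ᵇ v<u) | Graph.sym G v u | u~v = m≤n+m 1 _
    ... | tri≈ _ refl _ = contradiction (trans (sym u~v) (Graph.irrefl G u)) λ ()

    𝟙[adj]≤counted : ∀ u v → 𝟙 (adj G u v) ≤ counted u v + counted v u
    𝟙[adj]≤counted u v = by-cases (adj G u v) refl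
      where
      by-cases : ∀ b → adj G u v ≡ b → 𝟙 b ≤ counted u v + counted v u
      by-cases true  u~v = adjacent⇒counted u v u~v
      by-cases false _   = z≤n

    between : (Fin n → Bool) → (Fin n → Bool) → Fin n → Fin n → ℕ
    between a b u v = 𝟙 (adj G u v ∧ a u ∧ b v)

    module _ {a b : Fin n → Bool} (disjoint : ∀ v → a v ≡ true → b v ≡ false) where

      between-pair≤ : ∀ u v → between a b u v + between a b v u ≤ 𝟙 (adj G u v)
      between-pair≤ u v rewrite Graph.sym G v u with adj G u v
      ... | false = z≤n
      ... | true with a u in au
      ...   | false = 𝟙≤1 (a v ∧ b u)
      ...   | true rewrite disjoint u au | ∧-zeroʳ (a v) = ≤-trans (≤-reflexive (+-identityʳ _)) (𝟙≤1 (b v))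

      edgesBetween≤edgeCount : ∑[ u < n ] ∑[ v < n ] between a b u v ≤ edgeCount G
      edgesBetween≤edgeCount = half (begin
        B + B                                                        ≡⟨ cong (B +_) (∑-comm (between a b)) ⟩
        B + ∑[ u < n ] ∑[ v < n ] between a b v u                    ≡⟨ double-sum-+ (between a b) (λ u v → between a b v u) ⟨
        ∑[ u < n ] ∑[ v < n ] (between a b u v + between a b v u)    ≤⟨ double-sum-mono (λ u v → ≤-trans (between-pair≤ u v) (𝟙[adj]≤counted u v)) ⟩
        ∑[ u < n ] ∑[ v < n ] (counted u v + counted v u)            ≡⟨ double-sum-+ counted (λ u v → counted v u) ⟩
        E + ∑[ u < n ] ∑[ v < n ] counted v u                        ≡⟨ cong (E +_) (∑-comm counted) ⟨
        E + E                                                        ≡⟨ cong₂ _+_ edgeCount≡sum edgeCount≡sum ⟨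
        edgeCount G + edgeCount G                                    ∎)
        where
        open ≤-Reasoning
        B E : ℕ
        B = ∑[ u < n ] ∑[ v < n ] between a b u v
        E = ∑[ u < n ] ∑[ v < n ] counted u v
        half : ∀ {x y} → x + x ≤ y + y → x ≤ y
        half {x} {y} x+x≤y+y = ≮⇒≥ (λ y<x → <⇒≱ (+-mono-< y<x y<x) x+x≤y+y)

  module _ {n} (G : Graph n) {A B : Subset n} (icb : InducedCompleteBipartite G A B) where
    private
      A-independent : ∀ u v → u ∈ A → v ∈ A → adj G u v ≡ false
      A-independent = let (_ , _ , _ , indep , _ , _) = icb in indep
      B-independent : ∀ u v → u ∈ B → v ∈ B → adj G u v ≡ false
      B-independent = let (_ , _ , _ , _ , indep , _) = icb in indep
      complete : ∀ u v → u ∈ A → v ∈ B → adj G u v ≡ true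
      complete = let (_ , _ , _ , _ , _ , comp) = icb in comp
      complete′ : ∀ u v → u ∈ B → v ∈ A → adj G u v ≡ true
      complete′ u v u∈B v∈A = trans (Graph.sym G u v) (complete v u v∈A u∈B)

    nonadjacent-trans : ∀ {u v w} → u ∈ A ⊎ u ∈ B → v ∈ A ⊎ v ∈ B → w ∈ A ⊎ w ∈ B →
                        adj G u v ≡ false → adj G v w ≡ false → adj G u w ≡ false
    nonadjacent-trans (inj₁ u∈A) (inj₁ v∈A) (inj₁ w∈A) _   _   = A-independent _ _ u∈A w∈A
    nonadjacent-trans (inj₁ u∈A) (inj₁ v∈A) (inj₂ w∈B) _   v≁w = adjacent-and-not G (complete _ _ v∈A w∈B) v≁w
    nonadjacent-trans (inj₁ u∈A) (inj₂ v∈B) _          u≁v _   = adjacent-and-not G (complete _ _ u∈A v∈B) u≁v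
    nonadjacent-trans (inj₂ u∈B) (inj₁ v∈A) _          u≁v _   = adjacent-and-not G (complete′ _ _ u∈B v∈A) u≁v
    nonadjacent-trans (inj₂ u∈B) (inj₂ v∈B) (inj₁ w∈A) _   v≁w = adjacent-and-not G (complete′ _ _ v∈B w∈A) v≁w
    nonadjacent-trans (inj₂ u∈B) (inj₂ v∈B) (inj₂ w∈B) _   _   = B-independent _ _ u∈B w∈B

module ClassGCounting where
  open import Defs hiding (sym)
  open import Data.Nat using (ℕ; zero; suc; _+_; _*_; _∸_; _≤_; z≤n; s≤s)
  open import Data.Nat.Properties hiding (_≟_)
  open import Data.Rational using (ℚ)
  open import Data.Fin using (Fin; zero; suc; inject₁; fromℕ; _≟_)
  open import Data.Fin.Properties using (any?)
  open import Data.Fin.Subset using (Subset; _∈_; ∣_∣)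
  open import Data.Vec as Vec using ()
  open import Data.Vec.Properties using (lookup⇒[]=)
  open import Data.Bool using (Bool; true; false; T; not; _∧_; _∨_)
  open import Data.Bool.Properties using (T-∧; T-∨; T-≡)
  open import Data.List using (allFin)
  open import Data.Product using (Σ; _×_; _,_; proj₁; proj₂)
  open import Data.Sum as Sum using (_⊎_)
  open import Function using (_∘_; Equivalence)
  open import Relation.Binary.PropositionalEquality
  open import Relation.Nullary using (Dec; does; yes; no; contradiction; ¬_; _×-dec_; T?)
  open FinSum
  open GraphCounting

  inX inY inZ : ∀ {t} → Part t → Bool
  inX (xPart _) = true
  inX _         = false
  inY (yPart _) = true
  inY _         = false
  inZ (zPart _) = true
  inZ _         = false

  isZ : ∀ {t} → Fin t → Part t → Bool
  isZ i (zPart j) = does (i ≟ j)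
  isZ i _         = false

  𝟙[inX]≡sum : ∀ {t} (p : Part t) → 𝟙 (inX p) ≡ ∑[ i < suc t ] 𝟙 (isX i p)
  𝟙[inX]≡sum     (xPart j) = sym (sum-𝟙-≟ j)
  𝟙[inX]≡sum {t} (yPart _) = sym (sum-replicate-zero (suc t))
  𝟙[inX]≡sum {t} (zPart _) = sym (sum-replicate-zero (suc t))

  𝟙[inY]≡sum : ∀ {t} (p : Part t) → 𝟙 (inY p) ≡ ∑[ i < suc t ] 𝟙 (isY i p)
  𝟙[inY]≡sum {t} (xPart _) = sym (sum-replicate-zero (suc t))
  𝟙[inY]≡sum     (yPart j) = sym (sum-𝟙-≟ j)
  𝟙[inY]≡sum {t} (zPart _) = sym (sum-replicate-zero (suc t))

  𝟙[inZ]≡sum : ∀ {t} (p : Part t) → 𝟙 (inZ p) ≡ ∑[ i < t ] 𝟙 (isZ i p)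
  𝟙[inZ]≡sum {t} (xPart _) = sym (sum-replicate-zero t)
  𝟙[inZ]≡sum {t} (yPart _) = sym (sum-replicate-zero t)
  𝟙[inZ]≡sum     (zPart j) = sym (sum-𝟙-≟ j)

  𝟙-partition : ∀ {t} (p : Part t) → 𝟙 (inX p) + 𝟙 (inY p) + 𝟙 (inZ p) ≡ 1
  𝟙-partition (xPart _) = refl
  𝟙-partition (yPart _) = refl
  𝟙-partition (zPart _) = refl

  partSize≡sum : ∀ {n t} (lab : Fin n → Part t) (b : Part t → Bool) → partSize lab b ≡ ∑[ v < n ] 𝟙 (b (lab v))
  partSize≡sum {n} lab b = trans (length-filter-≡true (λ v → b (lab v)) (allFin n)) (sum-allFin (λ v → 𝟙 (b (lab v))))

  inX⇒¬inY : ∀ {t} (p : Part t) → inX p ≡ true → inY p ≡ false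
  inX⇒¬inY (xPart _) _  = refl
  inX⇒¬inY (yPart _) ()
  inX⇒¬inY (zPart _) ()

  isX≡true⇒ : ∀ {t} {i : Fin (suc t)} p → isX i p ≡ true → p ≡ xPart i
  isX≡true⇒ {i = i} (xPart j) i≟j with i ≟ j
  ... | yes refl = refl
  ... | no _     = contradiction i≟j λ ()

  isY≡true⇒ : ∀ {t} {i : Fin (suc t)} p → isY i p ≡ true → p ≡ yPart i
  isY≡true⇒ {i = i} (yPart j) i≟j with i ≟ j
  ... | yes refl = refl
  ... | no _     = contradiction i≟j λ ()

  isZ≡true⇒ : ∀ {t} {i : Fin t} p → isZ i p ≡ true → p ≡ zPart i
  isZ≡true⇒ {i = i} (zPart j) i≟j with i ≟ j
  ... | yes refl = refl
  ... | no _     = contradiction i≟j λ ()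

  module _ {k : ℕ} {α : ℚ} {n t : ℕ} {G : Graph n} (C : InClassG k α n t G) where
    open InClassG C

    #X #Y #Z : ℕ
    #X = ∑[ v < n ] 𝟙 (inX (lab v))
    #Y = ∑[ v < n ] 𝟙 (inY (lab v))
    #Z = ∑[ v < n ] 𝟙 (inZ (lab v))

    n≡#X+#Y+#Z : n ≡ #X + #Y + #Z
    n≡#X+#Y+#Z = begin
      n                                                   ≡⟨ *-identityʳ n ⟨
      n * 1                                               ≡⟨ sum-const n 1 ⟨
      ∑[ v < n ] 1                                        ≡⟨ sum-cong-≗ (λ v → 𝟙-partition (lab v)) ⟨
      ∑[ v < n ] (χX v + χY v + χZ v)                        ≡⟨ ∑-distrib-+ (λ v → χX v + χY v) χZ ⟩
      ∑[ v < n ] (χX v + χY v) + #Z                         ≡⟨ cong (_+ #Z) (∑-distrib-+ χX χY) ⟩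
      #X + #Y + #Z                                        ∎
      where
      open ≡-Reasoning
      χX χY χZ : Fin n → ℕ
      χX v = 𝟙 (inX (lab v))
      χY v = 𝟙 (inY (lab v))
      χZ v = 𝟙 (inZ (lab v))

    #Zᵢ≤2k-1 : ∀ i → ∑[ v < n ] 𝟙 (isZ i (lab v)) ≤ suc (2 * k ∸ 2)
    #Zᵢ≤2k-1 i = begin
      ∑[ v < n ] 𝟙 (isZ i (lab v))                        ≤⟨ sum-mono-≤ listed ⟩
      ∑[ v < n ] ∑[ j < m ] 𝟙 (does (v ≟ z i j))          ≡⟨ ∑-comm (λ v j → 𝟙 (does (v ≟ z i j))) ⟩
      ∑[ j < m ] ∑[ v < n ] 𝟙 (does (v ≟ z i j))          ≡⟨ sum-cong-≗ (λ j → sum-𝟙-≟ (z i j)) ⟩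
      ∑[ j < m ] 1                                        ≡⟨ sum-const m 1 ⟩
      m * 1                                               ≡⟨ *-identityʳ m ⟩
      m                                                   ∎
      where
      open ≤-Reasoning
      m : ℕ
      m = suc (2 * k ∸ 2)
      listed : ∀ v → 𝟙 (isZ i (lab v)) ≤ ∑[ j < m ] 𝟙 (does (v ≟ z i j))
      listed v with isZ i (lab v) in v∈Zᵢ
      ... | false = z≤n
      ... | true with z-onto i v (isZ≡true⇒ (lab v) v∈Zᵢ)
      ...   | j , refl = ≤-trans (≤-reflexive (cong 𝟙 (sym (does-≟-refl (z i j))))) (term≤sum (λ j′ → 𝟙 (does (z i j ≟ z i j′))) j)

    #Z≤t[2k-1] : #Z ≤ t * suc (2 * k ∸ 2)
    #Z≤t[2k-1] = begin
      #Z                                                  ≡⟨ sum-cong-≗ (λ v → 𝟙[inZ]≡sum (lab v)) ⟩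
      ∑[ v < n ] ∑[ i < t ] 𝟙 (isZ i (lab v))             ≡⟨ ∑-comm (λ v i → 𝟙 (isZ i (lab v))) ⟩
      ∑[ i < t ] ∑[ v < n ] 𝟙 (isZ i (lab v))             ≤⟨ sum-mono-≤ #Zᵢ≤2k-1 ⟩
      ∑[ i < t ] suc (2 * k ∸ 2)                          ≡⟨ sum-const t _ ⟩
      t * suc (2 * k ∸ 2)                                 ∎
      where open ≤-Reasoning

    module _ (s : ℕ) (Xᵢ-size : ∀ i → partSize lab (isX (inject₁ i)) ≡ s)
                     (Yᵢ-size : ∀ i → partSize lab (isY (inject₁ i)) ≡ s) where

      private
        sum-of-blocks : (block : Fin (suc t) → Part t → Bool) (union : Part t → Bool) →
                        (∀ p → 𝟙 (union p) ≡ ∑[ i < suc t ] 𝟙 (block i p)) →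
                        (∀ i → partSize lab (block (inject₁ i)) ≡ s) →
                        ∑[ v < n ] 𝟙 (union (lab v)) ≡ t * s + partSize lab (block (fromℕ t))
        sum-of-blocks block union 𝟙[union]≡sum block-size = begin
          ∑[ v < n ] 𝟙 (union (lab v))                            ≡⟨ sum-cong-≗ (λ v → 𝟙[union]≡sum (lab v)) ⟩
          ∑[ v < n ] ∑[ i < suc t ] 𝟙 (block i (lab v))          ≡⟨ ∑-comm (λ v i → 𝟙 (block i (lab v))) ⟩
          ∑[ i < suc t ] ∑[ v < n ] 𝟙 (block i (lab v))          ≡⟨ sum-cong-≗ (λ i → partSize≡sum lab (block i)) ⟨
          ∑[ i < suc t ] partSize lab (block i)                   ≡⟨ sum-init-last (λ i → partSize lab (block i)) ⟩
          ∑[ i < t ] partSize lab (block (inject₁ i)) + lastBlock ≡⟨ cong (_+ lastBlock) (sum-cong-≗ block-size) ⟩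
          ∑[ i < t ] s + lastBlock                                ≡⟨ cong (_+ lastBlock) (sum-const t s) ⟩
          t * s + lastBlock                                       ∎
          where
          open ≡-Reasoning
          lastBlock : ℕ
          lastBlock = partSize lab (block (fromℕ t))

      #X≡ts+#Xₜ₊₁ : #X ≡ t * s + partSize lab (isX (fromℕ t))
      #X≡ts+#Xₜ₊₁ = sum-of-blocks isX inX 𝟙[inX]≡sum Xᵢ-size

      #Y≡ts+#Yₜ₊₁ : #Y ≡ t * s + partSize lab (isY (fromℕ t))
      #Y≡ts+#Yₜ₊₁ = sum-of-blocks isY inY 𝟙[inY]≡sum Yᵢ-size

      sameBlockPairs : Fin n → Fin n → ℕ
      sameBlockPairs u v = ∑[ i < t ] (𝟙 (isX (inject₁ i) (lab u)) * 𝟙 (isY (inject₁ i) (lab v)))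

      ∑∑sameBlockPairs≡t[s*s] : ∑[ u < n ] ∑[ v < n ] sameBlockPairs u v ≡ t * (s * s)
      ∑∑sameBlockPairs≡t[s*s] = begin
        ∑[ u < n ] ∑[ v < n ] ∑[ i < t ] (x i u * y i v)    ≡⟨ sum-cong-≗ (λ u → ∑-comm (λ v i → x i u * y i v)) ⟩
        ∑[ u < n ] ∑[ i < t ] ∑[ v < n ] (x i u * y i v)    ≡⟨ ∑-comm (λ u i → ∑[ v < n ] (x i u * y i v)) ⟩
        ∑[ i < t ] ∑[ u < n ] ∑[ v < n ] (x i u * y i v)    ≡⟨ sum-cong-≗ (λ i → sum-cong-≗ (λ u → *-distribˡ-sum (x i u) (y i))) ⟨
        ∑[ i < t ] ∑[ u < n ] (x i u * sum (y i))           ≡⟨ sum-cong-≗ (λ i → *-distribʳ-sum (sum (y i)) (x i)) ⟨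
        ∑[ i < t ] (sum (x i) * sum (y i))                  ≡⟨ sum-cong-≗ (λ i → cong₂ _*_ (#Xᵢ≡s i) (#Yᵢ≡s i)) ⟩
        ∑[ i < t ] (s * s)                                  ≡⟨ sum-const t (s * s) ⟩
        t * (s * s)                                         ∎
        where
        open ≡-Reasoning
        x y : Fin t → Fin n → ℕ
        x i u = 𝟙 (isX (inject₁ i) (lab u))
        y i v = 𝟙 (isY (inject₁ i) (lab v))
        #Xᵢ≡s : ∀ i → sum (x i) ≡ s
        #Xᵢ≡s i = trans (sym (partSize≡sum lab (isX (inject₁ i)))) (Xᵢ-size i)
        #Yᵢ≡s : ∀ i → sum (y i) ≡ s
        #Yᵢ≡s i = trans (sym (partSize≡sum lab (isY (inject₁ i)))) (Yᵢ-size i)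

      pair-covered : ∀ u v → 𝟙 (inX (lab u)) * 𝟙 (inY (lab v))
                             ≤ sameBlockPairs u v + between G (inX ∘ lab) (inY ∘ lab) u v
      pair-covered u v with lab u in u∈X | lab v in v∈Y
      ... | yPart _ | _       = z≤n
      ... | zPart _ | _       = z≤n
      ... | xPart _ | xPart _ = z≤n
      ... | xPart _ | zPart _ = z≤n
      ... | xPart a | yPart b with a ≟ b
      ...   | no a≢b rewrite XiYj-all a b u v a≢b u∈X v∈Y = m≤n+m 1 _
      ...   | yes refl with lastOrInject₁ a
      ...     | last rewrite Xt1Yt1-all u v u∈X v∈Y = m≤n+m 1 _
      ...     | inject₁′ j = ≤-trans (subst (_≤ sum diagonal) (cong (λ b → 𝟙 b * 𝟙 b) (does-≟-refl (inject₁ j))) (term≤sum diagonal j))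
                                     (m≤m+n _ _)
        where
        diagonal : Fin t → ℕ
        diagonal i = 𝟙 (does (inject₁ i ≟ inject₁ j)) * 𝟙 (does (inject₁ i ≟ inject₁ j))

      #X*#Y≤e+t[s*s] : #X * #Y ≤ edgeCount G + t * (s * s)
      #X*#Y≤e+t[s*s] = begin
        #X * #Y                                                           ≡⟨ *-distribʳ-sum #Y χX ⟩
        ∑[ u < n ] (χX u * #Y)                                            ≡⟨ sum-cong-≗ (λ u → *-distribˡ-sum (χX u) χY) ⟩
        ∑[ u < n ] ∑[ v < n ] (χX u * χY v)                               ≤⟨ double-sum-mono pair-covered ⟩
        ∑[ u < n ] ∑[ v < n ] (sameBlockPairs u v + between G a b u v)    ≡⟨ double-sum-+ sameBlockPairs (between G a b) ⟩
        ∑[ u < n ] ∑[ v < n ] sameBlockPairs u v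
          + ∑[ u < n ] ∑[ v < n ] between G a b u v                       ≤⟨ +-mono-≤ (≤-reflexive ∑∑sameBlockPairs≡t[s*s])
                                                                               (edgesBetween≤edgeCount G X∩Y≡∅) ⟩
        t * (s * s) + edgeCount G                                         ≡⟨ +-comm (t * (s * s)) (edgeCount G) ⟩
        edgeCount G + t * (s * s)                                         ∎
        where
        open ≤-Reasoning
        χX χY : Fin n → ℕ
        χX v = 𝟙 (inX (lab v))
        χY v = 𝟙 (inY (lab v))
        a b : Fin n → Bool
        a = inX ∘ lab
        b = inY ∘ lab
        X∩Y≡∅ : ∀ v → a v ≡ true → b v ≡ false
        X∩Y≡∅ v = inX⇒¬inY (lab v)

      module _ {A B : Subset n} (icb : InducedCompleteBipartite G A B) where
        inW : Fin n → Bool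
        inW v = Vec.lookup A v ∨ Vec.lookup B v

        outside : Fin n → ℕ
        outside v = 𝟙 (not (inW v))

        inW⇒∈ : ∀ {v} → T (inW v) → v ∈ A ⊎ v ∈ B
        inW⇒∈ {v} v∈W = Sum.map (lookup⇒∈ A) (lookup⇒∈ B) (Equivalence.to T-∨ v∈W)
          where
          lookup⇒∈ : ∀ p → T (Vec.lookup p v) → v ∈ p
          lookup⇒∈ p v∈p = lookup⇒[]= v p (Equivalence.to T-≡ v∈p)

        ∣A∣+∣B∣+#outside≡n : ∣ A ∣ + ∣ B ∣ + sum outside ≡ n
        ∣A∣+∣B∣+#outside≡n = begin
          ∣ A ∣ + ∣ B ∣ + sum outside                          ≡⟨ cong₂ (λ a b → a + b + sum outside) (∣p∣≡sum A) (∣p∣≡sum B) ⟩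
          sum χA + sum χB + sum outside                        ≡⟨ cong (_+ sum outside) (∑-distrib-+ χA χB) ⟨
          ∑[ v < n ] (χA v + χB v) + sum outside               ≡⟨ ∑-distrib-+ (λ v → χA v + χB v) outside ⟨
          ∑[ v < n ] (χA v + χB v + outside v)                 ≡⟨ sum-cong-≗ partition ⟩
          ∑[ v < n ] 1                                         ≡⟨ sum-const n 1 ⟩
          n * 1                                                ≡⟨ *-identityʳ n ⟩
          n                                                    ∎
          where
          open ≡-Reasoning
          χA χB : Fin n → ℕ
          χA v = 𝟙 (Vec.lookup A v)
          χB v = 𝟙 (Vec.lookup B v)
          partition : ∀ v → χA v + χB v + outside v ≡ 1
          partition v with Vec.lookup A v in v∈A | Vec.lookup B v in v∈B
          ... | true  | true  = let (_ , _ , disjoint , _) = icb in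
                                contradiction (lookup⇒[]= v B v∈B) (disjoint v (lookup⇒[]= v A v∈A))
          ... | true  | false = refl
          ... | false | true  = refl
          ... | false | false = refl

        Meets : (Part t → Bool) → Set
        Meets block = Σ (Fin n) λ v → T (block (lab v) ∧ inW v)

        meets? : ∀ block → Dec (Meets block)
        meets? block = any? (λ v → T? (block (lab v) ∧ inW v))

        meets⇒ : ∀ {block p} → (∀ q → block q ≡ true → q ≡ p) → Meets block →
                 Σ (Fin n) λ v → lab v ≡ p × (v ∈ A ⊎ v ∈ B)
        meets⇒ {block} block⇒p (v , v∈block∩W) =
          v , block⇒p (lab v) (Equivalence.to T-≡ v∈block) , inW⇒∈ {v} v∈W
          where
          v∈block : T (block (lab v))
          v∈block = proj₁ (Equivalence.to T-∧ v∈block∩W)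
          v∈W : T (inW v)
          v∈W = proj₂ (Equivalence.to T-∧ v∈block∩W)

        -- x₀ and y₀ are non-adjacent, so they lie on the same side of the bipartition; a vertex of
        -- X ∪ Y outside Xₐ ∪ Yₐ is adjacent to exactly one of them, so it cannot be in A ∪ B.
        outside-Xₐ∪Yₐ-missed : ∀ a {x₀ y₀} → lab x₀ ≡ xPart (inject₁ a) → lab y₀ ≡ yPart (inject₁ a) →
                                x₀ ∈ A ⊎ x₀ ∈ B → y₀ ∈ A ⊎ y₀ ∈ B → ∀ v →
                                𝟙 (inX (lab v)) + 𝟙 (inY (lab v))
                                  ≤ outside v + (𝟙 (isX (inject₁ a) (lab v)) + 𝟙 (isY (inject₁ a) (lab v)))
        outside-Xₐ∪Yₐ-missed a {x₀} {y₀} x₀∈Xₐ y₀∈Yₐ x₀∈W y₀∈W v with lab v in v∈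
        ... | zPart _ = z≤n
        ... | xPart j with j ≟ inject₁ a
        ...   | yes refl rewrite does-≟-refl (inject₁ a) = m≤n+m 1 (outside v)
        ...   | no j≢a with inW v in v∈W
        ...     | false = s≤s z≤n
        ...     | true  = adjacent-and-not G (XiYj-all j (inject₁ a) v y₀ j≢a v∈ y₀∈Yₐ)
                            (nonadjacent-trans G icb (inW⇒∈ {v} (Equivalence.from T-≡ v∈W)) x₀∈W y₀∈W
                              (X-indep v x₀ j (inject₁ a) v∈ x₀∈Xₐ) (XiYi-none a x₀ y₀ x₀∈Xₐ y₀∈Yₐ))
        outside-Xₐ∪Yₐ-missed a {x₀} {y₀} x₀∈Xₐ y₀∈Yₐ x₀∈W y₀∈W v | yPart j with j ≟ inject₁ a
        ...   | yes refl rewrite does-≟-refl (inject₁ a) = m≤n+m 1 (outside v)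
        ...   | no j≢a with inW v in v∈W
        ...     | false = s≤s z≤n
        ...     | true  = adjacent-and-not G (XiYj-all (inject₁ a) j x₀ v (j≢a ∘ sym) x₀∈Xₐ v∈)
                            (nonadjacent-trans G icb x₀∈W y₀∈W (inW⇒∈ {v} (Equivalence.from T-≡ v∈W))
                              (XiYi-none a x₀ y₀ x₀∈Xₐ y₀∈Yₐ) (Y-indep y₀ v (inject₁ a) j y₀∈Yₐ v∈))

        ts≤#outside-if-some-pair-met : 2 ≤ t → ∀ a → Meets (isX (inject₁ a)) → Meets (isY (inject₁ a)) →
                                       t * s ≤ sum outside
        ts≤#outside-if-some-pair-met 2≤t a Xₐ-met Yₐ-met
          with meets⇒ isX≡true⇒ Xₐ-met | meets⇒ isY≡true⇒ Yₐ-met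
        ... | x₀ , x₀∈Xₐ , x₀∈W | y₀ , y₀∈Yₐ , y₀∈W = +-cancelʳ-≤ (t * s) (t * s) (sum outside) (begin
          t * s + t * s                                          ≤⟨ +-mono-≤ (m≤m+n (t * s) _) (m≤m+n (t * s) _) ⟩
          (t * s + partSize lab (isX (fromℕ t)))
            + (t * s + partSize lab (isY (fromℕ t)))             ≡⟨ cong₂ _+_ #X≡ts+#Xₜ₊₁ #Y≡ts+#Yₜ₊₁ ⟨
          #X + #Y                                                ≡⟨ ∑-distrib-+ χX χY ⟨
          ∑[ v < n ] (χX v + χY v)                               ≤⟨ sum-mono-≤ (outside-Xₐ∪Yₐ-missed a x₀∈Xₐ y₀∈Yₐ x₀∈W y₀∈W) ⟩
          ∑[ v < n ] (outside v + (χXₐ v + χYₐ v))               ≡⟨ ∑-distrib-+ outside (λ v → χXₐ v + χYₐ v) ⟩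
          sum outside + ∑[ v < n ] (χXₐ v + χYₐ v)               ≡⟨ cong (sum outside +_) (∑-distrib-+ χXₐ χYₐ) ⟩
          sum outside + (sum χXₐ + sum χYₐ)                      ≡⟨ cong (λ m → sum outside + m) (cong₂ _+_ #Xₐ≡s #Yₐ≡s) ⟩
          sum outside + (s + s)                                  ≤⟨ +-monoʳ-≤ (sum outside) 2s≤ts ⟩
          sum outside + t * s                                    ∎)
          where
          open ≤-Reasoning
          χX χY χXₐ χYₐ : Fin n → ℕ
          χX v = 𝟙 (inX (lab v))
          χY v = 𝟙 (inY (lab v))
          χXₐ v = 𝟙 (isX (inject₁ a) (lab v))
          χYₐ v = 𝟙 (isY (inject₁ a) (lab v))
          #Xₐ≡s : sum χXₐ ≡ s
          #Xₐ≡s = trans (sym (partSize≡sum lab (isX (inject₁ a)))) (Xᵢ-size a)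
          #Yₐ≡s : sum χYₐ ≡ s
          #Yₐ≡s = trans (sym (partSize≡sum lab (isY (inject₁ a)))) (Yᵢ-size a)
          2s≤ts : s + s ≤ t * s
          2s≤ts = subst (_≤ t * s) (cong (s +_) (+-identityʳ s)) (*-monoˡ-≤ s 2≤t)

        unmet : ∀ a → Dec (Meets (isX (inject₁ a))) → Fin n → ℕ
        unmet a (yes _) v = 𝟙 (isY (inject₁ a) (lab v))
        unmet a (no _)  v = 𝟙 (isX (inject₁ a) (lab v))

        #unmet≡s : ∀ a d → sum (unmet a d) ≡ s
        #unmet≡s a (yes _) = trans (sym (partSize≡sum lab (isY (inject₁ a)))) (Yᵢ-size a)
        #unmet≡s a (no _)  = trans (sym (partSize≡sum lab (isX (inject₁ a)))) (Xᵢ-size a)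

        unmet⇒outside : (∀ a → ¬ (Meets (isX (inject₁ a)) × Meets (isY (inject₁ a)))) →
                        ∀ a d v → unmet a d v ≤ outside v * (𝟙 (isX (inject₁ a) (lab v)) + 𝟙 (isY (inject₁ a) (lab v)))
        unmet⇒outside no-pair-met a (no Xₐ-unmet) v with isX (inject₁ a) (lab v) in v∈Xₐ
        ... | false = z≤n
        ... | true with inW v in v∈W
        ...   | false = s≤s z≤n
        ...   | true  = contradiction (v , subst T (sym (cong₂ _∧_ v∈Xₐ v∈W)) _) Xₐ-unmet
        unmet⇒outside no-pair-met a (yes Xₐ-met) v with isY (inject₁ a) (lab v) in v∈Yₐ
        ... | false = z≤n
        ... | true with inW v in v∈W
        ...   | false = subst (1 ≤_) (sym (+-identityʳ _)) (m≤n+m 1 _)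
        ...   | true  = contradiction (Xₐ-met , (v , subst T (sym (cong₂ _∧_ v∈Yₐ v∈W)) _)) (no-pair-met a)

        blocks-disjoint : ∀ p → ∑[ a < t ] (𝟙 (isX (inject₁ a) p) + 𝟙 (isY (inject₁ a) p)) ≤ 1
        blocks-disjoint p = begin
          ∑[ a < t ] (x (inject₁ a) + y (inject₁ a))                 ≡⟨ ∑-distrib-+ (x ∘ inject₁) (y ∘ inject₁) ⟩
          ∑[ a < t ] x (inject₁ a) + ∑[ a < t ] y (inject₁ a)        ≤⟨ +-mono-≤ (sum-init≤sum x) (sum-init≤sum y) ⟩
          sum x + sum y                                              ≡⟨ cong₂ _+_ (𝟙[inX]≡sum p) (𝟙[inY]≡sum p) ⟨
          𝟙 (inX p) + 𝟙 (inY p)                                      ≤⟨ m≤m+n _ (𝟙 (inZ p)) ⟩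
          𝟙 (inX p) + 𝟙 (inY p) + 𝟙 (inZ p)                          ≡⟨ 𝟙-partition p ⟩
          1                                                          ∎
          where
          open ≤-Reasoning
          x y : Fin (suc t) → ℕ
          x i = 𝟙 (isX i p)
          y i = 𝟙 (isY i p)

        ts≤#outside-if-no-pair-met : (∀ a → ¬ (Meets (isX (inject₁ a)) × Meets (isY (inject₁ a)))) →
                                     t * s ≤ sum outside
        ts≤#outside-if-no-pair-met no-pair-met = begin
          t * s                                                  ≡⟨ sum-const t s ⟨
          ∑[ a < t ] s                                           ≡⟨ sum-cong-≗ (λ a → #unmet≡s a (Xₐ-met? a)) ⟨
          ∑[ a < t ] ∑[ v < n ] missed a v             ≡⟨ ∑-comm missed ⟩
          ∑[ v < n ] ∑[ a < t ] missed a v             ≤⟨ double-sum-mono (λ v a → unmet⇒outside no-pair-met a (Xₐ-met? a) v) ⟩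
          ∑[ v < n ] ∑[ a < t ] (outside v * χₐ a v)             ≡⟨ sum-cong-≗ (λ v → *-distribˡ-sum (outside v) (λ a → χₐ a v)) ⟨
          ∑[ v < n ] (outside v * ∑[ a < t ] χₐ a v)             ≤⟨ sum-mono-≤ (λ v → *-monoʳ-≤ (outside v) (blocks-disjoint (lab v))) ⟩
          ∑[ v < n ] (outside v * 1)                             ≡⟨ sum-cong-≗ (λ v → *-identityʳ (outside v)) ⟩
          sum outside                                            ∎
          where
          open ≤-Reasoning
          Xₐ-met? : ∀ a → Dec (Meets (isX (inject₁ a)))
          Xₐ-met? a = meets? (isX (inject₁ a))
          missed : Fin t → Fin n → ℕ
          missed a = unmet a (Xₐ-met? a)
          χₐ : Fin t → Fin n → ℕ
          χₐ a v = 𝟙 (isX (inject₁ a) (lab v)) + 𝟙 (isY (inject₁ a) (lab v))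

        ∣A∣+∣B∣+ts≤n : 2 ≤ t → ∣ A ∣ + ∣ B ∣ + t * s ≤ n
        ∣A∣+∣B∣+ts≤n 2≤t = subst (∣ A ∣ + ∣ B ∣ + t * s ≤_) ∣A∣+∣B∣+#outside≡n
                                 (+-monoʳ-≤ (∣ A ∣ + ∣ B ∣) ts≤#outside)
          where
          ts≤#outside : t * s ≤ sum outside
          ts≤#outside with any? (λ a → meets? (isX (inject₁ a)) ×-dec meets? (isY (inject₁ a)))
          ... | yes (a , Xₐ-met , Yₐ-met) = ts≤#outside-if-some-pair-met 2≤t a Xₐ-met Yₐ-met
          ... | no no-pair-met           = ts≤#outside-if-no-pair-met (λ a met → no-pair-met (a , met))

module CeilingSqrt where
  open import Defs using (ℕ→ℚ; IsCeilSqrt; divℕ)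
  open import Data.Nat as ℕ using (ℕ; suc)
  import Data.Nat.Properties as ℕP
  open import Data.Rational
  open import Data.Rational.Properties
  open import Data.Product using (proj₁; proj₂)
  open import Relation.Binary.PropositionalEquality
  open import Relation.Nullary using (yes; no; contradiction)
  open import Relation.Nullary.Decidable using (toWitness)
  open ℕ→ℚ-Properties

  divℕ-*-cancel : ∀ q d .{{_ : ℕ.NonZero d}} → divℕ q d * ℕ→ℚ d ≡ q
  divℕ-*-cancel q d@(suc _) = p*1/n*n≡p q d

  *-ℕ→ℚ-mono-≤ : ∀ d {p q} → p ≤ q → p * ℕ→ℚ d ≤ q * ℕ→ℚ d
  *-ℕ→ℚ-mono-≤ d = *-monoʳ-≤-nonNeg (ℕ→ℚ d) {{nonNegative (ℕ→ℚ-nonNeg d)}}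

  module _ {u : ℚ} {d : ℕ} .{{_ : ℕ.NonZero d}} where

    ceilSqrt-upper : ∀ {t} → IsCeilSqrt (divℕ u d) t → u ≤ ℕ→ℚ (t ℕ.* t) * ℕ→ℚ d
    ceilSqrt-upper t-ceil = subst (_≤ _) (divℕ-*-cancel u d) (*-ℕ→ℚ-mono-≤ d (proj₁ t-ceil))

    ceilSqrt-lower : ∀ {t} → IsCeilSqrt (divℕ u d) (suc t) → ℕ→ℚ (t ℕ.* t) * ℕ→ℚ d ≤ u
    ceilSqrt-lower {t} t-ceil = subst (_ ≤_) (divℕ-*-cancel u d) (*-ℕ→ℚ-mono-≤ d (<⇒≤ t²<x))
      where
      t²<x : ℕ→ℚ (t ℕ.* t) < divℕ u d
      t²<x = ≰⇒> (λ x≤t² → ℕP.<-irrefl refl (proj₂ t-ceil t x≤t²))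

  2≤ceilSqrt : ∀ {k u t} → 1 ℕ.≤ k → ℕ→ℚ (36 ℕ.* k) ≤ u → IsCeilSqrt (divℕ u (4 ℕ.* k)) t → 2 ℕ.≤ t
  2≤ceilSqrt {k} {u} {t} 1≤k 36k≤u t-ceil with 2 ℕ.≤? t
  ... | yes 2≤t = 2≤t
  ... | no 2≰t  = contradiction 36≤4 (ℕP.<⇒≱ (toWitness {a? = 4 ℕ.<? 36} _))
    where
    instance
      k≢0 : ℕ.NonZero k
      k≢0 = ℕ.>-nonZero 1≤k
      4k≢0 : ℕ.NonZero (4 ℕ.* k)
      4k≢0 = ℕP.m*n≢0 4 k
    t≤1 : t ℕ.≤ 1
    t≤1 = ℕP.≤-pred (ℕP.≰⇒> 2≰t)
    36k≤4k : 36 ℕ.* k ℕ.≤ 4 ℕ.* k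
    36k≤4k = begin
      36 ℕ.* k                   ≤⟨ ℕ→ℚ-cancel-≤ (≤-trans 36k≤u (subst (u ≤_) (sym (ℕ→ℚ-* (t ℕ.* t) (4 ℕ.* k))) (ceilSqrt-upper t-ceil))) ⟩
      t ℕ.* t ℕ.* (4 ℕ.* k)      ≤⟨ ℕP.*-monoˡ-≤ (4 ℕ.* k) (ℕP.*-mono-≤ t≤1 t≤1) ⟩
      1 ℕ.* (4 ℕ.* k)            ≡⟨ ℕP.*-identityˡ (4 ℕ.* k) ⟩
      4 ℕ.* k                    ∎
      where open ℕP.≤-Reasoning
    36≤4 : 36 ℕ.≤ 4
    36≤4 = ℕP.*-cancelʳ-≤ 36 4 k 36k≤4k

open import Defs
open import Data.Nat using (ℕ; suc) renaming (_≤_ to _≤ℕ_; _*_ to _*ℕ_)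
open import Data.Integer using (+_)
open import Data.Rational using (ℚ; _<_; _≤_; _*_; _+_; _-_; _/_; 0ℚ; 1ℚ; ½)
open import Data.Fin.Subset using (Subset; ∣_∣)
open import Data.Product using (_×_)
open import Data.Sum using (_⊎_)

-- t is written suc t′ so that the block size of condition (ii) unfolds.
module ClassGBounds {k : ℕ} {α : ℚ} {n t′ : ℕ} {G : Graph n}
                   (2≤k : 2 ≤ℕ k) (α<½ : α < ½) (36k≤αn : ℕ→ℚ (36 *ℕ k) ≤ α * ℕ→ℚ n)
                   (t-ceil : IsCeilSqrt (divℕ (α * ℕ→ℚ n) (4 *ℕ k)) (suc t′)) (2≤t : 2 ≤ℕ suc t′)
                   (C : InClassG k α n (suc t′) G) where
  import Data.Nat as ℕ
  import Data.Nat.Properties as ℕP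
  import Data.Integer.Properties as ℤP
  open import Data.Rational hiding (∣_∣)
  open import Data.Rational.Properties
  open import Data.Rational.Solver using (module +-*-Solver)
  open import Data.Fin using (zero; inject₁; fromℕ)
  open import Data.Product using (_,_; proj₁; proj₂)
  open import Relation.Binary.PropositionalEquality
    using (_≡_; refl; trans; cong; cong₂; subst; subst₂; module ≡-Reasoning)
  import Relation.Binary.PropositionalEquality as ≡
  open +-*-Solver
  open ℕ→ℚ-Properties
  open ℚ-Inequalities
  open CeilingSqrt
  open ClassGCounting
  open InClassG C

  t s #Xₜ₊₁ #Yₜ₊₁ : ℕ
  t = suc t′
  s = partSize lab (isX (inject₁ zero))
  #Xₜ₊₁ = partSize lab (isX (fromℕ t))
  #Yₜ₊₁ = partSize lab (isY (fromℕ t))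

  K N u T S P Q E Zmax : ℚ
  K = ℕ→ℚ k
  N = ℕ→ℚ n
  u = α * N
  T = ℕ→ℚ t
  S = ℕ→ℚ s
  P = ℕ→ℚ #Xₜ₊₁
  Q = ℕ→ℚ #Yₜ₊₁
  E = ℕ→ℚ (edgeCount G)
  Zmax = (+ 2 / 1 * K - 1ℚ) * T

  instance
    k≢0 : ℕ.NonZero k
    k≢0 = ℕ.>-nonZero (ℕP.<⇒≤ 2≤k)
    4k≢0 : ℕ.NonZero (4 ℕ.* k)
    4k≢0 = ℕP.m*n≢0 4 k

  2≤K : + 2 / 1 ≤ K
  2≤K = ℕ→ℚ-mono-≤ 2≤k

  1≤K : 1ℚ ≤ K
  1≤K = ≤-trans (ℕ→ℚ-mono-≤ {1} {2} (ℕ.s≤s ℕ.z≤n)) 2≤K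

  0≤K : 0ℚ ≤ K
  0≤K = ℕ→ℚ-nonNeg k

  0<T : 0ℚ < T
  0<T = positive⁻¹ T {{normalize-pos t 1}}

  36K≤u : + 36 / 1 * K ≤ u
  36K≤u = subst (_≤ u) (ℕ→ℚ-* 36 k) 36k≤αn

  1≤u : 1ℚ ≤ u
  1≤u = ≤-by-difference
    (solve 2 (λ u K → u :- con 1ℚ := (u :- con (+ 36 / 1) :* K) :+ con (+ 36 / 1) :* (K :- con 1ℚ) :+ con (+ 35 / 1)) refl u K)
    (0≤+ (0≤+ (≤⇒0≤- 36K≤u) (0≤* (0≤/ 36 1) (≤⇒0≤- 1≤K))) (0≤/ 35 1))

  0≤u : 0ℚ ≤ u
  0≤u = ≤-trans (0≤/ 1 1) 1≤u

  2u≤N : + 2 / 1 * u ≤ N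
  2u≤N = ≤-by-difference
    (solve 2 (λ α N → N :- con (+ 2 / 1) :* (α :* N) := con (+ 2 / 1) :* ((con ½ :- α) :* N)) refl α N)
    (0≤* (0≤/ 2 1) (0≤* (≤⇒0≤- (<⇒≤ α<½)) (ℕ→ℚ-nonNeg n)))

  1≤N : 1ℚ ≤ N
  1≤N = ≤-trans 1≤u (≤-trans (≤-by-difference (solve 1 (λ u → con (+ 2 / 1) :* u :- u := u) refl u) 0≤u) 2u≤N)

  m²·4k≡4Kmm : ∀ m → ℕ→ℚ (m ℕ.* m) * ℕ→ℚ (4 ℕ.* k) ≡ + 4 / 1 * K * ℕ→ℚ m * ℕ→ℚ m
  m²·4k≡4Kmm m = trans (cong₂ _*_ (ℕ→ℚ-* m m) (ℕ→ℚ-* 4 k))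
    (solve 2 (λ M K → M :* M :* (con (+ 4 / 1) :* K) := con (+ 4 / 1) :* K :* M :* M) refl (ℕ→ℚ m) K)

  u≤4KT² : u ≤ + 4 / 1 * K * T * T
  u≤4KT² = subst (u ≤_) (m²·4k≡4Kmm t) (ceilSqrt-upper t-ceil)

  4K[T-1]²≤u : + 4 / 1 * K * (T - 1ℚ) * (T - 1ℚ) ≤ u
  4K[T-1]²≤u = subst (λ x → + 4 / 1 * K * x * x ≤ u) (≡.sym T-1≡t′) (subst (_≤ u) (m²·4k≡4Kmm t′) (ceilSqrt-lower t-ceil))
    where
    T-1≡t′ : T - 1ℚ ≡ ℕ→ℚ t′
    T-1≡t′ = trans (cong (_- 1ℚ) (ℕ→ℚ-suc t′)) (solve 1 (λ x → x :+ con 1ℚ :- con 1ℚ := x) refl (ℕ→ℚ t′))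

  Xᵢ-size : ∀ i → partSize lab (isX (inject₁ i)) ≡ s
  Xᵢ-size i = ℤP.+-injective (trans (X-size i) (≡.sym (X-size zero)))

  Yᵢ-size : ∀ i → partSize lab (isY (inject₁ i)) ≡ s
  Yᵢ-size i = ℤP.+-injective (trans (Y-size i) (≡.sym (X-size zero)))

  ℕ→ℚ[2k∸1] : ℕ→ℚ (2 ℕ.* k ℕ.∸ 1) ≡ + 2 / 1 * K - 1ℚ
  ℕ→ℚ[2k∸1] = trans (ℕ→ℚ-∸ {2 ℕ.* k} {1} (ℕP.≤-trans (ℕ.s≤s ℕ.z≤n) (ℕP.*-monoʳ-≤ 2 2≤k))) (cong (_- 1ℚ) (ℕ→ℚ-* 2 k))

  -- Condition (ii), s = ⌊(αn − (2k−1)t)/2t⌋, multiplied out by 2t.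
  2TS≤u-Zmax×u-Zmax≤2T[S+1] : (+ 2 / 1 * T * S ≤ u - Zmax) × (u - Zmax ≤ + 2 / 1 * T * (S + 1ℚ))
  2TS≤u-Zmax×u-Zmax≤2T[S+1] =
    subst₂ _≤_ (scale S) q·2t≡u-Zmax (*-ℕ→ℚ-mono-≤ (2 ℕ.* t) (proj₁ s≤q≤s+1)) ,
    subst₂ _≤_ q·2t≡u-Zmax (trans (cong (_* ℕ→ℚ (2 ℕ.* t)) (ℕ→ℚ-suc s)) (scale (S + 1ℚ)))
      (*-ℕ→ℚ-mono-≤ (2 ℕ.* t) (proj₂ s≤q≤s+1))
    where
    q : ℚ
    q = (u - ℕ→ℚ ((2 ℕ.* k ℕ.∸ 1) ℕ.* t)) * (+ 1 / (2 ℕ.* t))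
    s≤q≤s+1 : (ℕ→ℚ s ≤ q) × (q ≤ ℕ→ℚ (suc s))
    s≤q≤s+1 = floor-bounds q s (≡.sym (X-size zero))
    q·2t≡u-Zmax : q * ℕ→ℚ (2 ℕ.* t) ≡ u - Zmax
    q·2t≡u-Zmax = trans (p*1/n*n≡p _ (2 ℕ.* t))
      (cong (λ x → u - x) (trans (ℕ→ℚ-* (2 ℕ.* k ℕ.∸ 1) t) (cong (_* T) ℕ→ℚ[2k∸1])))
    scale : ∀ x → x * ℕ→ℚ (2 ℕ.* t) ≡ + 2 / 1 * T * x
    scale x = trans (cong (x *_) (ℕ→ℚ-* 2 t))
      (solve 2 (λ x T → x :* (con (+ 2 / 1) :* T) := con (+ 2 / 1) :* T :* x) refl x T)

  0≤Zmax : 0ℚ ≤ Zmax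
  0≤Zmax = 0≤* (0≤-resp-≡ (solve 1 (λ K → con (+ 2 / 1) :* K :- con 1ℚ := con (+ 2 / 1) :* (K :- con 1ℚ) :+ con 1ℚ) refl K)
                  (0≤+ (0≤* (0≤/ 2 1) (≤⇒0≤- 1≤K)) (0≤/ 1 1)))
               (<⇒≤ 0<T)

  0≤2TS : 0ℚ ≤ + 2 / 1 * T * S
  0≤2TS = 0≤* (0≤* (0≤/ 2 1) (<⇒≤ 0<T)) (ℕ→ℚ-nonNeg s)

  2TS≤u : + 2 / 1 * T * S ≤ u
  2TS≤u = ≤-by-difference (solve 4 (λ u Z T S → u :- con (+ 2 / 1) :* T :* S := (u :- Z :- con (+ 2 / 1) :* T :* S) :+ Z) refl u Zmax T S)
            (0≤+ (≤⇒0≤- (proj₁ 2TS≤u-Zmax×u-Zmax≤2T[S+1])) 0≤Zmax)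

  Zmax≤N : Zmax ≤ N
  Zmax≤N = ≤-by-difference
    (solve 5 (λ N u Z T S → N :- Z := (N :- con (+ 2 / 1) :* u) :+ (u :- Z :- con (+ 2 / 1) :* T :* S) :+ u :+ con (+ 2 / 1) :* T :* S)
      refl N u Zmax T S)
    (0≤+ (0≤+ (0≤+ (≤⇒0≤- 2u≤N) (≤⇒0≤- (proj₁ 2TS≤u-Zmax×u-Zmax≤2T[S+1]))) 0≤u) 0≤2TS)

  ℕ→ℚ[ts+p] : ∀ p → ℕ→ℚ (t ℕ.* s ℕ.+ p) ≡ T * S + ℕ→ℚ p
  ℕ→ℚ[ts+p] p = trans (ℕ→ℚ-+ (t ℕ.* s) p) (cong (_+ ℕ→ℚ p) (ℕ→ℚ-* t s))

  ℕ→ℚ-#X : ℕ→ℚ (#X C) ≡ T * S + P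
  ℕ→ℚ-#X = trans (cong ℕ→ℚ (#X≡ts+#Xₜ₊₁ C s Xᵢ-size Yᵢ-size)) (ℕ→ℚ[ts+p] #Xₜ₊₁)

  ℕ→ℚ-#Y : ℕ→ℚ (#Y C) ≡ T * S + Q
  ℕ→ℚ-#Y = trans (cong ℕ→ℚ (#Y≡ts+#Yₜ₊₁ C s Xᵢ-size Yᵢ-size)) (ℕ→ℚ[ts+p] #Yₜ₊₁)

  ℕ→ℚ-Zmax : ℕ→ℚ (t ℕ.* (2 ℕ.* k ℕ.∸ 1)) ≡ Zmax
  ℕ→ℚ-Zmax = trans (ℕ→ℚ-* t (2 ℕ.* k ℕ.∸ 1)) (trans (*-comm T _) (cong (_* T) ℕ→ℚ[2k∸1]))

  N≤x+y+Zmax : N ≤ (T * S + P) + (T * S + Q) + Zmax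
  N≤x+y+Zmax = subst (N ≤_) cast (ℕ→ℚ-mono-≤ n≤#X+#Y+t[2k-1])
    where
    #Z≤t[2k∸1] : #Z C ℕ.≤ t ℕ.* (2 ℕ.* k ℕ.∸ 1)
    #Z≤t[2k∸1] = subst (λ m → #Z C ℕ.≤ t ℕ.* m) (≡.sym (ℕP.+-∸-assoc 1 (ℕP.*-monoʳ-≤ 2 (ℕP.<⇒≤ 2≤k)))) (#Z≤t[2k-1] C)
    n≤#X+#Y+t[2k-1] : n ℕ.≤ #X C ℕ.+ #Y C ℕ.+ t ℕ.* (2 ℕ.* k ℕ.∸ 1)
    n≤#X+#Y+t[2k-1] = subst (ℕ._≤ #X C ℕ.+ #Y C ℕ.+ t ℕ.* (2 ℕ.* k ℕ.∸ 1)) (≡.sym (n≡#X+#Y+#Z C))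
                        (ℕP.+-monoʳ-≤ (#X C ℕ.+ #Y C) #Z≤t[2k∸1])
    cast : ℕ→ℚ (#X C ℕ.+ #Y C ℕ.+ t ℕ.* (2 ℕ.* k ℕ.∸ 1)) ≡ (T * S + P) + (T * S + Q) + Zmax
    cast = trans (ℕ→ℚ-+ (#X C ℕ.+ #Y C) _)
             (cong₂ _+_ (trans (ℕ→ℚ-+ (#X C) (#Y C)) (cong₂ _+_ ℕ→ℚ-#X ℕ→ℚ-#Y)) ℕ→ℚ-Zmax)

  xy≤E+TSS : (T * S + P) * (T * S + Q) ≤ E + T * S * S
  xy≤E+TSS = subst₂ _≤_ castˡ castʳ (ℕ→ℚ-mono-≤ (#X*#Y≤e+t[s*s] C s Xᵢ-size Yᵢ-size))
    where
    castˡ : ℕ→ℚ (#X C ℕ.* #Y C) ≡ (T * S + P) * (T * S + Q)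
    castˡ = trans (ℕ→ℚ-* (#X C) (#Y C)) (cong₂ _*_ ℕ→ℚ-#X ℕ→ℚ-#Y)
    castʳ : ℕ→ℚ (edgeCount G ℕ.+ t ℕ.* (s ℕ.* s)) ≡ E + T * S * S
    castʳ = trans (ℕ→ℚ-+ (edgeCount G) (t ℕ.* (s ℕ.* s)))
      (cong (λ e → E + e) (trans (ℕ→ℚ-* t (s ℕ.* s)) (trans (cong (T *_) (ℕ→ℚ-* s s)) (≡.sym (*-assoc T S S)))))

  P≤Q+1 : P ≤ Q + 1ℚ
  P≤Q+1 = subst (P ≤_) (ℕ→ℚ-suc #Yₜ₊₁) (ℕ→ℚ-mono-≤ (proj₁ balanced))

  Q≤P+1 : Q ≤ P + 1ℚ
  Q≤P+1 = subst (Q ≤_) (ℕ→ℚ-suc #Xₜ₊₁) (ℕ→ℚ-mono-≤ (proj₂ balanced))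

  D : ℚ
  D = ℕ→ℚ (n ℕ.* n) * (+ 1 / 4) - E

  4D≤4K[T-1]N+4KN+4TS²+1 : + 4 / 1 * D ≤ + 4 / 1 * K * (T - 1ℚ) * N + + 4 / 1 * K * N + + 4 / 1 * T * S * S + 1ℚ
  4D≤4K[T-1]N+4KN+4TS²+1 = begin
    + 4 / 1 * D                                        ≡⟨ cong (λ m → + 4 / 1 * (m * (+ 1 / 4) - E)) (ℕ→ℚ-* n n) ⟩
    + 4 / 1 * (N * N * (+ 1 / 4) - E)                   ≡⟨ solve 2 (λ N E → con (+ 4 / 1) :* (N :* N :* con (+ 1 / 4) :- E)
                                                                          := N :* N :- con (+ 4 / 1) :* E) refl N E ⟩
    N * N - + 4 / 1 * E                                 ≤⟨ deficit-bound {N} {T * S + P} {T * S + Q} {Zmax} {E} {T * S * S}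
                                                             (0≤+ 0≤TS (ℕ→ℚ-nonNeg #Xₜ₊₁)) (0≤+ 0≤TS (ℕ→ℚ-nonNeg #Yₜ₊₁))
                                                             Zmax≤N N≤x+y+Zmax (shift P≤Q+1) (shift Q≤P+1) xy≤E+TSS ⟩
    + 2 / 1 * Zmax * N + + 4 / 1 * (T * S * S) + 1ℚ     ≤⟨ ≤-by-difference slack (0≤* (0≤* (0≤/ 2 1) (<⇒≤ 0<T)) (ℕ→ℚ-nonNeg n)) ⟩
    + 4 / 1 * K * (T - 1ℚ) * N + + 4 / 1 * K * N + + 4 / 1 * T * S * S + 1ℚ ∎
    where
    open ≤-Reasoning
    0≤TS : 0ℚ ≤ T * S
    0≤TS = 0≤* (<⇒≤ 0<T) (ℕ→ℚ-nonNeg s)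
    shift : ∀ {a b} → a ≤ b + 1ℚ → T * S + a ≤ T * S + b + 1ℚ
    shift {a} {b} a≤b+1 = subst (T * S + a ≤_) (≡.sym (+-assoc (T * S) b 1ℚ)) (+-monoʳ-≤ (T * S) a≤b+1)
    slack : + 4 / 1 * K * (T - 1ℚ) * N + + 4 / 1 * K * N + + 4 / 1 * T * S * S + 1ℚ
              - (+ 2 / 1 * Zmax * N + + 4 / 1 * (T * S * S) + 1ℚ) ≡ + 2 / 1 * T * N
    slack = solve 4 (λ K T N S →
      con (+ 4 / 1) :* K :* (T :- con 1ℚ) :* N :+ con (+ 4 / 1) :* K :* N :+ con (+ 4 / 1) :* T :* S :* S :+ con 1ℚ
        :- (con (+ 2 / 1) :* ((con (+ 2 / 1) :* K :- con 1ℚ) :* T) :* N :+ con (+ 4 / 1) :* (T :* S :* S) :+ con 1ℚ)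
      := con (+ 2 / 1) :* T :* N) refl K T N S

  edge-bound : (D ≤ 0ℚ) ⊎ (D * D ≤ ℕ→ℚ (4 ℕ.* k ℕ.* (n ℕ.* n ℕ.* n)) * α)
  edge-bound = subst (λ R → D ≤ 0ℚ ⊎ D * D ≤ R) 4KNNu≡4kn³α
    (deficit²-bound {D} {+ 4 / 1 * K * (T - 1ℚ) * N} {+ 4 / 1 * K * N} {+ 4 / 1 * T * S * S} {K * N * N * u}
      4D≤4K[T-1]N+4KN+4TS²+1
      (4k[t-1]n-sq≤ {K} {N} {u} {T} 0≤K 4K[T-1]²≤u)
      (4kn-sq≤ {K} {N} {u} 0≤K 36K≤u)
      (4ts²-sq≤ {K} {N} {u} {T} {S} 0<T 0≤K (ℕ→ℚ-nonNeg s) 2TS≤u u≤4KT² 2u≤N)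
      (1≤knnu {K} {N} {u} 1≤K 1≤N 1≤u))
    where
    open ≡-Reasoning
    4KNNu≡4kn³α : + 4 / 1 * (K * N * N * u) ≡ ℕ→ℚ (4 ℕ.* k ℕ.* (n ℕ.* n ℕ.* n)) * α
    4KNNu≡4kn³α = ≡.sym (begin
      ℕ→ℚ (4 ℕ.* k ℕ.* (n ℕ.* n ℕ.* n)) * α
        ≡⟨ cong (_* α) (trans (ℕ→ℚ-* (4 ℕ.* k) _) (cong₂ _*_ (ℕ→ℚ-* 4 k) (trans (ℕ→ℚ-* (n ℕ.* n) n) (cong (_* N) (ℕ→ℚ-* n n))))) ⟩
      + 4 / 1 * K * (N * N * N) * α
        ≡⟨ solve 3 (λ K N α → con (+ 4 / 1) :* K :* (N :* N :* N) :* α := con (+ 4 / 1) :* (K :* N :* N :* (α :* N))) refl K N α ⟩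
      + 4 / 1 * (K * N * N * u) ∎)

  bipartite-bound : ∀ (A B : Subset n) → InducedCompleteBipartite G A B →
                    ℕ→ℚ (∣ A ∣ ℕ.+ ∣ B ∣) ≤ (1ℚ - α * (+ 1 / 4)) * N
  bipartite-bound A B icb = ≤-by-difference split (0≤+ (≤⇒0≤- L+TS≤N) (≤⇒0≤- u/4≤TS))
    where
    L : ℚ
    L = ℕ→ℚ (∣ A ∣ ℕ.+ ∣ B ∣)
    L+TS≤N : L + T * S ≤ N
    L+TS≤N = subst (_≤ N) (trans (ℕ→ℚ-+ (∣ A ∣ ℕ.+ ∣ B ∣) (t ℕ.* s)) (cong (λ x → L + x) (ℕ→ℚ-* t s)))
               (ℕ→ℚ-mono-≤ (∣A∣+∣B∣+ts≤n C s Xᵢ-size Yᵢ-size icb 2≤t))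
    u/4≤TS : u * (+ 1 / 4) ≤ T * S
    u/4≤TS = u/4≤ts {K} {u} {T} {S} ([4k+2]t≤u {K} {u} {T} 2≤K 36K≤u 4K[T-1]²≤u) (proj₂ 2TS≤u-Zmax×u-Zmax≤2T[S+1])
    split : (1ℚ - α * (+ 1 / 4)) * N - L ≡ (N - (L + T * S)) + (T * S - u * (+ 1 / 4))
    split = solve 5 (λ α N L T S → (con 1ℚ :- α :* con (+ 1 / 4)) :* N :- L
                      := (N :- (L :+ T :* S)) :+ (T :* S :- (α :* N) :* con (+ 1 / 4))) refl α N L T S

open import Data.Nat using (s≤s)
open import Data.Nat.Properties using (<⇒≤)
open import Data.Product using (_,_)

proposition4p3 :
    ∀ (k : ℕ) (α : ℚ) (n t : ℕ) (G : Graph n) →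
    2 ≤ℕ k → 0ℚ < α → α < ½ →
    ℕ→ℚ (36 *ℕ k) ≤ α * ℕ→ℚ n →
    IsCeilSqrt (divℕ (α * ℕ→ℚ n) (4 *ℕ k)) t →
    InClassG k α n t G →
    MaximalCycleFree G (suc (2 *ℕ k)) →
    -- e(G) ≥ n²/4 − 2√(kα) n^{3/2}, i.e. D ≤ 2√(kα n³) with D = n²/4 − e(G)
    ((ℕ→ℚ (n *ℕ n) * (+ 1 / 4) - ℕ→ℚ (edgeCount G) ≤ 0ℚ)
      ⊎ ((ℕ→ℚ (n *ℕ n) * (+ 1 / 4) - ℕ→ℚ (edgeCount G))
          * (ℕ→ℚ (n *ℕ n) * (+ 1 / 4) - ℕ→ℚ (edgeCount G))
          ≤ ℕ→ℚ (4 *ℕ k *ℕ (n *ℕ n *ℕ n)) * α))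
    × (∀ (A B : Subset n) → InducedCompleteBipartite G A B →
         ℕ→ℚ (∣ A ∣ Data.Nat.+ ∣ B ∣) ≤ (1ℚ - α * (+ 1 / 4)) * ℕ→ℚ n)
proposition4p3 k α n t G 2≤k _ α<½ 36k≤αn t-ceil C _ with CeilingSqrt.2≤ceilSqrt (<⇒≤ 2≤k) 36k≤αn t-ceil
... | 2≤t@(s≤s _) = edge-bound , bipartite-bound
  where open ClassGBounds 2≤k α<½ 36k≤αn t-ceil 2≤t C
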